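{- (Restricted name substitutions.) In $LG^\omega$, let $\Pi$ be a proof of $\Sigma,x{:}\iota;B_1,\dots,B_n\vdash B_0$, where $\iota$ is a nominal type. Let $a_0,\dots,a_n$ be nominal constants of type $\iota$ such that $a_i\notin supp(B_i)$ for each $i\in\{0,\dots,n\}$. Then there exists a proof $\Pi'$ of $\Sigma;B_1[a_1/x],\dots,B_n[a_n/x]\vdash B_0[a_0/x]$ such that $ht(\Pi')\le ht(\Pi)$.
   Context: Logic $LG^\omega$. Terms: Church's simply typed $\lambda$-calculus; formulas have type $o$; quantifier types do not contain $o$. There are distinguished nominal types, each with infinitely many nominal constants, plus a set $\mathcal K$ of other constants. A permutation $\pi$ is a finite type-preserving bijection on nominal constants, acting on terms by $\pi.t$. $supp(t)$ = set of nominal constants in $t$. $\Sigma$-substitutions map variables to terms with no nominal constants. Sequents: $\Sigma;\Gamma\vdash C$, $\Gamma$ a multiset, free variables among $\Sigma$. Rules: $id_\pi$ ($\Sigma;\Gamma,B\vdash B'$ if $\pi.B=\pi'.B'$ for some permutations); multicut $mc$ (from $\Sigma;\Delta_i\vdash B_i$, $i=1..n$, and $\Sigma;B_1..B_n,\Gamma\vdash C$ infer $\Sigma;\Delta_1..\Delta_n,\Gamma\vdash C$); contraction; $\bot L$, $\top R$; usual $\land,\lor,\supset$ rules; $\forall L$, $\exists R$ instantiate with any well-typed term over $\Sigma$, $\mathcal K$ and nominal constants; $\forall R$ (resp. $\exists L$): from $\Sigma,h;\Gamma\vdash B[h\,\vec c/x]$ infer $\Sigma;\Gamma\vdash\forall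 x.B$ (dually on the left for $\exists$), $h\notin\Sigma$, $\vec c$ listing $supp(B)$, $h$ of type raised over the types of $\vec c$; $\nabla L,\nabla R$: replace the $\nabla$-bound variable (of nominal type) by a nominal constant $a\notin supp(B)$; $eqR$: $\Sigma;\Gamma\vdash t=t$; $eqL$: from premises $\Sigma\theta;\Gamma\theta\vdash C\theta$ for every $\Sigma$-substitution $\theta$ with $(\lambda\vec c.s)\theta=_{\beta\eta}(\lambda\vec c.t)\theta$, $\vec c$ listing $supp(s=t)$, infer $\Sigma;\Gamma,s=t\vdash C$; $defL/defR$: unfold an atom $p\,\vec t$ to $B[\vec t/\vec x]$ for a stratified definition clause $\forall\vec x.p\,\vec x\stackrel{\triangle}{=}B$ (body level $\le$ level of $p$, where implication raises the level of its antecedent by one, and body free of nominal constants); $natR$: $\vdash nat\,z$, and from $\Gamma\vdash nat\,I$ infer $\Gamma\vdash nat\,(s\,I)$; $natL$: from $\vdash D\,z$, $j;D\,j\vdash D\,(s\,j)$ and $\Sigma;\Gamma,D\,I\vdash C$ infer $\Sigma;\Gamma,nat\,I\vdash C$. Height $ht(\Pi)$ is the least upper bound of $ht(\Pi_i)+1$ over premise derivations $\Pi_i$. -}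

module Defs where

-- Terms: intrinsically typed (de Bruijn) simply typed λ-terms over types
-- that do not contain o; formulas are a separate syntax of type o whose
-- atoms are equations, nat-atoms and defined predicates applied to terms.

open import Data.Nat using (ℕ; zero; suc; _⊔_; _≤_; _≟_)
open import Data.Fin using (Fin)
import Data.Fin as Fin
import Data.Sum
open import Data.List using (List; []; _∷_; _++_; map; concat; tabulate)
open import Data.List.Membership.Propositional using (_∈_)
open import Data.List.Relation.Unary.Unique.Propositional using (Unique)
open import Data.List.Relation.Binary.Permutation.Propositional using (_↭_)
open import Data.Maybe using (Maybe; just)
open import Data.Product using (Σ; Σ-syntax; _×_; _,_)
open import Data.Sum using (_⊎_)
open import Data.Unit using (⊤)
open import Data.Empty using (⊥)
open import Relation.Nullary using (¬_; yes; no)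
open import Relation.Binary.PropositionalEquality using (_≡_; refl)

data Ty : Set where
  nom  : ℕ → Ty
  base : ℕ → Ty
  num  : Ty
  _⇒_  : Ty → Ty → Ty

infixr 5 _⇒_

Ctx : Set
Ctx = List Ty

data Var : Ctx → Ty → Set where
  here  : ∀ {Γ τ} → Var (τ ∷ Γ) τ
  there : ∀ {Γ τ σ} → Var Γ τ → Var (σ ∷ Γ) τ

-- a nominal constant: (index of its nominal type , index of the constant)
NomC : Set
NomC = ℕ × ℕ

record Sig : Set₁ where
  field
    K     : Set
    kty   : K → Ty
    P     : Set
    pargs : P → List Ty

module LG (𝒮 : Sig) where
  open Sig 𝒮

  data Tm (Γ : Ctx) : Ty → Set where
    var  : ∀ {τ} → Var Γ τ → Tm Γ τ
    nomc : (ι k : ℕ) → Tm Γ (nom ι)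
    con  : (c : K) → Tm Γ (kty c)
    zc   : Tm Γ num
    sc   : Tm Γ (num ⇒ num)
    lam  : ∀ {τ σ} → Tm (τ ∷ Γ) σ → Tm Γ (τ ⇒ σ)
    app  : ∀ {τ σ} → Tm Γ (τ ⇒ σ) → Tm Γ τ → Tm Γ σ

  data Tms (Γ : Ctx) : List Ty → Set where
    []  : Tms Γ []
    _∷_ : ∀ {τ Δ} → Tm Γ τ → Tms Γ Δ → Tms Γ (τ ∷ Δ)

  Ren : Ctx → Ctx → Set
  Ren Γ Δ = ∀ {τ} → Var Γ τ → Var Δ τ

  extR : ∀ {Γ Δ σ} → Ren Γ Δ → Ren (σ ∷ Γ) (σ ∷ Δ)
  extR ρ here      = here
  extR ρ (there v) = there (ρ v)

  ren : ∀ {Γ Δ τ} → Ren Γ Δ → Tm Γ τ → Tm Δ τ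
  ren ρ (var v)    = var (ρ v)
  ren ρ (nomc ι k) = nomc ι k
  ren ρ (con c)    = con c
  ren ρ zc         = zc
  ren ρ sc         = sc
  ren ρ (lam t)    = lam (ren (extR ρ) t)
  ren ρ (app t u)  = app (ren ρ t) (ren ρ u)

  Sub : Ctx → Ctx → Set
  Sub Γ Δ = ∀ {τ} → Var Γ τ → Tm Δ τ

  extS : ∀ {Γ Δ σ} → Sub Γ Δ → Sub (σ ∷ Γ) (σ ∷ Δ)
  extS θ here      = var here
  extS θ (there v) = ren there (θ v)

  sub : ∀ {Γ Δ τ} → Sub Γ Δ → Tm Γ τ → Tm Δ τ
  sub θ (var v)    = θ v
  sub θ (nomc ι k) = nomc ι k
  sub θ (con c)    = con c
  sub θ zc         = zc
  sub θ sc         = sc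
  sub θ (lam t)    = lam (sub (extS θ) t)
  sub θ (app t u)  = app (sub θ t) (sub θ u)

  renTs : ∀ {Γ Δ Ξ} → Ren Γ Δ → Tms Γ Ξ → Tms Δ Ξ
  renTs ρ []       = []
  renTs ρ (t ∷ ts) = ren ρ t ∷ renTs ρ ts

  subTs : ∀ {Γ Δ Ξ} → Sub Γ Δ → Tms Γ Ξ → Tms Δ Ξ
  subTs θ []       = []
  subTs θ (t ∷ ts) = sub θ t ∷ subTs θ ts

  inst : ∀ {Γ τ} → Tm Γ τ → Sub (τ ∷ Γ) Γ
  inst u here      = u
  inst u (there v) = var v

  tmsSub : ∀ {Γ Δ} → Tms Γ Δ → Sub Δ Γ
  tmsSub (t ∷ ts) here      = t
  tmsSub (t ∷ ts) (there v) = tmsSub ts v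

  data _≈_ : ∀ {Γ τ} → Tm Γ τ → Tm Γ τ → Set where
    ≈refl  : ∀ {Γ τ} {t : Tm Γ τ} → t ≈ t
    ≈sym   : ∀ {Γ τ} {t u : Tm Γ τ} → t ≈ u → u ≈ t
    ≈trans : ∀ {Γ τ} {t u v : Tm Γ τ} → t ≈ u → u ≈ v → t ≈ v
    ≈lam   : ∀ {Γ τ σ} {t u : Tm (τ ∷ Γ) σ} → t ≈ u → lam t ≈ lam u
    ≈app   : ∀ {Γ τ σ} {t t' : Tm Γ (τ ⇒ σ)} {u u' : Tm Γ τ} →
             t ≈ t' → u ≈ u' → app t u ≈ app t' u'
    ≈β     : ∀ {Γ τ σ} (t : Tm (τ ∷ Γ) σ) (u : Tm Γ τ) →
             app (lam t) u ≈ sub (inst u) t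
    ≈η     : ∀ {Γ τ σ} (t : Tm Γ (τ ⇒ σ)) →
             t ≈ lam (app (ren there t) (var here))

  data _≈s_ : ∀ {Γ Δ} → Tms Γ Δ → Tms Γ Δ → Set where
    []  : ∀ {Γ} → _≈s_ {Γ} [] []
    _∷_ : ∀ {Γ τ Δ} {t u : Tm Γ τ} {ts us : Tms Γ Δ} →
          t ≈ u → ts ≈s us → (t ∷ ts) ≈s (u ∷ us)

  data Fm (Γ : Ctx) : Set where
    top bot     : Fm Γ
    _and_ _or_ _imp_ : Fm Γ → Fm Γ → Fm Γ
    all ex      : (τ : Ty) → Fm (τ ∷ Γ) → Fm Γ
    nab         : (ι : ℕ) → Fm (nom ι ∷ Γ) → Fm Γ
    eq          : (τ : Ty) → Tm Γ τ → Tm Γ τ → Fm Γ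
    nat         : Tm Γ num → Fm Γ
    atm         : (p : P) → Tms Γ (pargs p) → Fm Γ

  renF : ∀ {Γ Δ} → Ren Γ Δ → Fm Γ → Fm Δ
  renF ρ top       = top
  renF ρ bot       = bot
  renF ρ (B and C) = renF ρ B and renF ρ C
  renF ρ (B or C)  = renF ρ B or renF ρ C
  renF ρ (B imp C) = renF ρ B imp renF ρ C
  renF ρ (all τ B) = all τ (renF (extR ρ) B)
  renF ρ (ex τ B)  = ex τ (renF (extR ρ) B)
  renF ρ (nab ι B) = nab ι (renF (extR ρ) B)
  renF ρ (eq τ s t) = eq τ (ren ρ s) (ren ρ t)
  renF ρ (nat t)   = nat (ren ρ t)
  renF ρ (atm p ts) = atm p (renTs ρ ts)

  subF : ∀ {Γ Δ} → Sub Γ Δ → Fm Γ → Fm Δ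
  subF θ top       = top
  subF θ bot       = bot
  subF θ (B and C) = subF θ B and subF θ C
  subF θ (B or C)  = subF θ B or subF θ C
  subF θ (B imp C) = subF θ B imp subF θ C
  subF θ (all τ B) = all τ (subF (extS θ) B)
  subF θ (ex τ B)  = ex τ (subF (extS θ) B)
  subF θ (nab ι B) = nab ι (subF (extS θ) B)
  subF θ (eq τ s t) = eq τ (sub θ s) (sub θ t)
  subF θ (nat t)   = nat (sub θ t)
  subF θ (atm p ts) = atm p (subTs θ ts)

  wkF : ∀ {Γ σ} → Fm Γ → Fm (σ ∷ Γ)
  wkF = renF there

  data _≈F_ : ∀ {Γ} → Fm Γ → Fm Γ → Set where
    top : ∀ {Γ} → _≈F_ {Γ} top top
    bot : ∀ {Γ} → _≈F_ {Γ} bot bot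
    cand : ∀ {Γ} {B B' C C' : Fm Γ} → B ≈F B' → C ≈F C' → (B and C) ≈F (B' and C')
    cor : ∀ {Γ} {B B' C C' : Fm Γ} → B ≈F B' → C ≈F C' → (B or C) ≈F (B' or C')
    cimp : ∀ {Γ} {B B' C C' : Fm Γ} → B ≈F B' → C ≈F C' → (B imp C) ≈F (B' imp C')
    all : ∀ {Γ τ} {B B' : Fm (τ ∷ Γ)} → B ≈F B' → all τ B ≈F all τ B'
    ex  : ∀ {Γ τ} {B B' : Fm (τ ∷ Γ)} → B ≈F B' → ex τ B ≈F ex τ B'
    nab : ∀ {Γ ι} {B B' : Fm (nom ι ∷ Γ)} → B ≈F B' → nab ι B ≈F nab ι B'
    eq  : ∀ {Γ τ} {s s' t t' : Tm Γ τ} → s ≈ s' → t ≈ t' → eq τ s t ≈F eq τ s' t'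
    nat : ∀ {Γ} {t t' : Tm Γ num} → t ≈ t' → nat t ≈F nat t'
    atm : ∀ {Γ p} {ts ts' : Tms Γ (pargs p)} → ts ≈s ts' → atm p ts ≈F atm p ts'

  occT : ∀ {Γ τ} → NomC → Tm Γ τ → Set
  occT a (var v)    = ⊥
  occT a (nomc ι k) = (ι , k) ≡ a
  occT a (con c)    = ⊥
  occT a zc         = ⊥
  occT a sc         = ⊥
  occT a (lam t)    = occT a t
  occT a (app t u)  = occT a t ⊎ occT a u

  occTs : ∀ {Γ Δ} → NomC → Tms Γ Δ → Set
  occTs a []       = ⊥
  occTs a (t ∷ ts) = occT a t ⊎ occTs a ts

  occF : ∀ {Γ} → NomC → Fm Γ → Set
  occF a top       = ⊥
  occF a bot       = ⊥
  occF a (B and C) = occF a B ⊎ occF a C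
  occF a (B or C)  = occF a B ⊎ occF a C
  occF a (B imp C) = occF a B ⊎ occF a C
  occF a (all τ B) = occF a B
  occF a (ex τ B)  = occF a B
  occF a (nab ι B) = occF a B
  occF a (eq τ s t) = occT a s ⊎ occT a t
  occF a (nat t)   = occT a t
  occF a (atm p ts) = occTs a ts

  Lists : ∀ {Γ} → List NomC → Fm Γ → Set
  Lists cs B = Unique cs × (∀ a → (a ∈ cs → occF a B) × (occF a B → a ∈ cs))

  NomFreeSub : ∀ {Γ Δ} → Sub Γ Δ → Set
  NomFreeSub {Γ} θ = ∀ {τ} (v : Var Γ τ) (a : NomC) → ¬ occT a (θ v)

  raise : List NomC → Ty → Ty
  raise []             τ = τ
  raise ((ι , k) ∷ cs) τ = nom ι ⇒ raise cs τ

  appNoms : ∀ {Γ τ} (cs : List NomC) → Tm Γ (raise cs τ) → Tm Γ τ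
  appNoms []             t = t
  appNoms ((ι , k) ∷ cs) t = appNoms cs (app t (nomc ι k))

  absAt : ∀ {Γ Δ τ} (ι k : ℕ) → Ren Γ Δ → Var Δ (nom ι) → Tm Γ τ → Tm Δ τ
  absAt ι k ρ x (var v) = var (ρ v)
  absAt ι k ρ x (nomc ι' k') with ι ≟ ι' | k ≟ k'
  ... | yes refl | yes refl = var x
  ... | _        | _        = nomc ι' k'
  absAt ι k ρ x (con c)   = con c
  absAt ι k ρ x zc        = zc
  absAt ι k ρ x sc        = sc
  absAt ι k ρ x (lam t)   = lam (absAt ι k (extR ρ) (there x) t)
  absAt ι k ρ x (app t u) = app (absAt ι k ρ x t) (absAt ι k ρ x u)

  absN : ∀ {Γ τ} (cs : List NomC) → Tm Γ τ → Tm Γ (raise cs τ)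
  absN []             t = t
  absN ((ι , k) ∷ cs) t = lam (absN cs (absAt ι k there here t))

  raiseSub : ∀ {Γ τ} (cs : List NomC) → Sub (τ ∷ Γ) (raise cs τ ∷ Γ)
  raiseSub cs here      = appNoms cs (var here)
  raiseSub cs (there v) = var (there v)

  record Perm : Set where
    field
      f g  : ℕ → ℕ → ℕ
      fg   : ∀ ι k → f ι (g ι k) ≡ k
      gf   : ∀ ι k → g ι (f ι k) ≡ k
      dom  : List NomC
      fin  : ∀ ι k → ¬ ((ι , k) ∈ dom) → f ι k ≡ k

  permT : ∀ {Γ τ} → Perm → Tm Γ τ → Tm Γ τ
  permT π (var v)    = var v
  permT π (nomc ι k) = nomc ι (Perm.f π ι k)
  permT π (con c)    = con c
  permT π zc         = zc
  permT π sc         = sc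
  permT π (lam t)    = lam (permT π t)
  permT π (app t u)  = app (permT π t) (permT π u)

  permTs : ∀ {Γ Δ} → Perm → Tms Γ Δ → Tms Γ Δ
  permTs π []       = []
  permTs π (t ∷ ts) = permT π t ∷ permTs π ts

  permF : ∀ {Γ} → Perm → Fm Γ → Fm Γ
  permF π top       = top
  permF π bot       = bot
  permF π (B and C) = permF π B and permF π C
  permF π (B or C)  = permF π B or permF π C
  permF π (B imp C) = permF π B imp permF π C
  permF π (all τ B) = all τ (permF π B)
  permF π (ex τ B)  = ex τ (permF π B)
  permF π (nab ι B) = nab ι (permF π B)
  permF π (eq τ s t) = eq τ (permT π s) (permT π t)
  permF π (nat t)   = nat (permT π t)
  permF π (atm p ts) = atm p (permTs π ts)

  lvl : (P → ℕ) → ∀ {Γ} → Fm Γ → ℕ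
  lvl L top        = 0
  lvl L bot        = 0
  lvl L (B and C)  = lvl L B ⊔ lvl L C
  lvl L (B or C)   = lvl L B ⊔ lvl L C
  lvl L (B imp C)  = suc (lvl L B) ⊔ lvl L C
  lvl L (all τ B)  = lvl L B
  lvl L (ex τ B)   = lvl L B
  lvl L (nab ι B)  = lvl L B
  lvl L (eq τ s t) = 0
  lvl L (nat t)    = 0
  lvl L (atm p ts) = L p

  -- clause p = just B  represents  ∀ x⃗. p x⃗ ≜ B  (x⃗ = the variables pargs p)
  record Definitions : Set where
    field
      clause  : (p : P) → Maybe (Fm (pargs p))
      level   : P → ℕ
      nomfree : ∀ p B → clause p ≡ just B → ∀ a → ¬ occF a B
      strat   : ∀ p B → clause p ≡ just B → lvl level B ≤ level p

  module Seq (𝒟 : Definitions) where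
    open Definitions 𝒟

    sSub : Sub (num ∷ []) (num ∷ [])
    sSub here = app sc (var here)

    closedInst : ∀ {Γ τ} → Tm Γ τ → Sub (τ ∷ []) Γ
    closedInst t here = t

    data Proof : (Σ : Ctx) → List (Fm Σ) → Fm Σ → Set where
      idπ   : ∀ {Σ Γ Γ₀ B C} → Γ ↭ (B ∷ Γ₀) → (π π' : Perm) →
              permF π B ≈F permF π' C → Proof Σ Γ C
      mc    : ∀ {Σ Γ Γ₀ C} (n : ℕ) (Δs : Fin n → List (Fm Σ)) (Bs : Fin n → Fm Σ) →
              ((i : Fin n) → Proof Σ (Δs i) (Bs i)) →
              Proof Σ (tabulate Bs ++ Γ₀) C →
              Γ ↭ (concat (tabulate Δs) ++ Γ₀) → Proof Σ Γ C
      cL    : ∀ {Σ Γ Γ₀ B C} → Γ ↭ (B ∷ Γ₀) → Proof Σ (B ∷ B ∷ Γ₀) C → Proof Σ Γ C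
      botL  : ∀ {Σ Γ Γ₀ C} → Γ ↭ (bot ∷ Γ₀) → Proof Σ Γ C
      topR  : ∀ {Σ Γ} → Proof Σ Γ top
      andL₁ : ∀ {Σ Γ Γ₀ B D C} → Γ ↭ ((B and D) ∷ Γ₀) → Proof Σ (B ∷ Γ₀) C → Proof Σ Γ C
      andL₂ : ∀ {Σ Γ Γ₀ B D C} → Γ ↭ ((B and D) ∷ Γ₀) → Proof Σ (D ∷ Γ₀) C → Proof Σ Γ C
      andR  : ∀ {Σ Γ B D} → Proof Σ Γ B → Proof Σ Γ D → Proof Σ Γ (B and D)
      orL   : ∀ {Σ Γ Γ₀ B D C} → Γ ↭ ((B or D) ∷ Γ₀) →
              Proof Σ (B ∷ Γ₀) C → Proof Σ (D ∷ Γ₀) C → Proof Σ Γ C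
      orR₁  : ∀ {Σ Γ B D} → Proof Σ Γ B → Proof Σ Γ (B or D)
      orR₂  : ∀ {Σ Γ B D} → Proof Σ Γ D → Proof Σ Γ (B or D)
      impL  : ∀ {Σ Γ Γ₀ B D C} → Γ ↭ ((B imp D) ∷ Γ₀) →
              Proof Σ Γ₀ B → Proof Σ (D ∷ Γ₀) C → Proof Σ Γ C
      impR  : ∀ {Σ Γ B D} → Proof Σ (B ∷ Γ) D → Proof Σ Γ (B imp D)
      allL  : ∀ {Σ Γ Γ₀ τ B C} → Γ ↭ (all τ B ∷ Γ₀) → (t : Tm Σ τ) →
              Proof Σ (subF (inst t) B ∷ Γ₀) C → Proof Σ Γ C
      allR  : ∀ {Σ Γ τ B} (cs : List NomC) → Lists cs (all τ B) →
              Proof (raise cs τ ∷ Σ) (map wkF Γ) (subF (raiseSub cs) B) →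
              Proof Σ Γ (all τ B)
      exL   : ∀ {Σ Γ Γ₀ τ B C} → Γ ↭ (ex τ B ∷ Γ₀) → (cs : List NomC) →
              Lists cs (ex τ B) →
              Proof (raise cs τ ∷ Σ) (subF (raiseSub cs) B ∷ map wkF Γ₀) (wkF C) →
              Proof Σ Γ C
      exR   : ∀ {Σ Γ τ B} (t : Tm Σ τ) → Proof Σ Γ (subF (inst t) B) → Proof Σ Γ (ex τ B)
      nabL  : ∀ {Σ Γ Γ₀ ι B C} → Γ ↭ (nab ι B ∷ Γ₀) → (k : ℕ) → ¬ occF (ι , k) B →
              Proof Σ (subF (inst (nomc ι k)) B ∷ Γ₀) C → Proof Σ Γ C
      nabR  : ∀ {Σ Γ ι B} (k : ℕ) → ¬ occF (ι , k) B →
              Proof Σ Γ (subF (inst (nomc ι k)) B) → Proof Σ Γ (nab ι B)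
      eqR   : ∀ {Σ Γ τ} {s t : Tm Σ τ} → s ≈ t → Proof Σ Γ (eq τ s t)
      eqL   : ∀ {Σ Γ Γ₀ τ C} {s t : Tm Σ τ} → Γ ↭ (eq τ s t ∷ Γ₀) →
              (cs : List NomC) → Lists cs (eq τ s t) →
              ((Σ' : Ctx) (θ : Sub Σ Σ') → NomFreeSub θ →
                 sub θ (absN cs s) ≈ sub θ (absN cs t) →
                 Proof Σ' (map (subF θ) Γ₀) (subF θ C)) →
              Proof Σ Γ C
      defL  : ∀ {Σ Γ Γ₀ C p B} {ts : Tms Σ (pargs p)} → Γ ↭ (atm p ts ∷ Γ₀) →
              clause p ≡ just B → Proof Σ (subF (tmsSub ts) B ∷ Γ₀) C → Proof Σ Γ C
      defR  : ∀ {Σ Γ p B} {ts : Tms Σ (pargs p)} →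
              clause p ≡ just B → Proof Σ Γ (subF (tmsSub ts) B) → Proof Σ Γ (atm p ts)
      natRz : ∀ {Σ Γ} {t : Tm Σ num} → t ≈ zc → Proof Σ Γ (nat t)
      natRs : ∀ {Σ Γ} {t I : Tm Σ num} → t ≈ app sc I →
              Proof Σ Γ (nat I) → Proof Σ Γ (nat t)
      natL  : ∀ {Σ Γ Γ₀ C} {I : Tm Σ num} → Γ ↭ (nat I ∷ Γ₀) →
              (D : Fm (num ∷ [])) →
              Proof [] [] (subF (inst zc) D) →
              Proof (num ∷ []) (D ∷ []) (subF sSub D) →
              Proof Σ (subF (closedInst I) D ∷ Γ₀) C →
              Proof Σ Γ C

    record AnyProof : Set where
      constructor ⟨_⟩
      field
        {ctx}  : Ctx
        {hyps} : List (Fm ctx)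
        {goal} : Fm ctx
        der    : Proof ctx hyps goal

    Prem : ∀ {Σ Γ C} → Proof Σ Γ C → Set
    Prem (idπ _ _ _ _)       = ⊥
    Prem (mc n _ _ _ _ _)    = Fin n ⊎ ⊤
    Prem (cL _ _)            = ⊤
    Prem (botL _)            = ⊥
    Prem topR                = ⊥
    Prem (andL₁ _ _)         = ⊤
    Prem (andL₂ _ _)         = ⊤
    Prem (andR _ _)          = Fin 2
    Prem (orL _ _ _)         = Fin 2
    Prem (orR₁ _)            = ⊤
    Prem (orR₂ _)            = ⊤
    Prem (impL _ _ _)        = Fin 2
    Prem (impR _)            = ⊤
    Prem (allL _ _ _)        = ⊤
    Prem (allR _ _ _)        = ⊤
    Prem (exL _ _ _ _)       = ⊤
    Prem (exR _ _)           = ⊤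
    Prem (nabL _ _ _ _)      = ⊤
    Prem (nabR _ _ _)        = ⊤
    Prem (eqR _)             = ⊥
    Prem (eqL {Σ = Σ} {s = s} {t} _ cs _ _) =
      Σ[ Σ' ∈ Ctx ] Σ[ θ ∈ Sub Σ Σ' ]
        (NomFreeSub θ × (sub θ (absN cs s) ≈ sub θ (absN cs t)))
    Prem (defL _ _ _)        = ⊤
    Prem (defR _ _)          = ⊤
    Prem (natRz _)           = ⊥
    Prem (natRs _ _)         = ⊤
    Prem (natL _ _ _ _ _)    = Fin 3

    prem : ∀ {Σ Γ C} (d : Proof Σ Γ C) → Prem d → AnyProof
    prem (mc n _ _ ds d _) (Data.Sum.inj₁ i) = ⟨ ds i ⟩
    prem (mc n _ _ ds d _) (Data.Sum.inj₂ _) = ⟨ d ⟩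
    prem (cL _ d) _          = ⟨ d ⟩
    prem (andL₁ _ d) _       = ⟨ d ⟩
    prem (andL₂ _ d) _       = ⟨ d ⟩
    prem (andR d e) Fin.zero = ⟨ d ⟩
    prem (andR d e) (Fin.suc _) = ⟨ e ⟩
    prem (orL _ d e) Fin.zero = ⟨ d ⟩
    prem (orL _ d e) (Fin.suc _) = ⟨ e ⟩
    prem (orR₁ d) _          = ⟨ d ⟩
    prem (orR₂ d) _          = ⟨ d ⟩
    prem (impL _ d e) Fin.zero = ⟨ d ⟩
    prem (impL _ d e) (Fin.suc _) = ⟨ e ⟩
    prem (impR d) _          = ⟨ d ⟩
    prem (allL _ _ d) _      = ⟨ d ⟩
    prem (allR _ _ d) _      = ⟨ d ⟩
    prem (exL _ _ _ d) _     = ⟨ d ⟩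
    prem (exR _ d) _         = ⟨ d ⟩
    prem (nabL _ _ _ d) _    = ⟨ d ⟩
    prem (nabR _ _ d) _      = ⟨ d ⟩
    prem (eqL _ _ _ ds) (Σ' , θ , nf , u) = ⟨ ds Σ' θ nf u ⟩
    prem (defL _ _ d) _      = ⟨ d ⟩
    prem (defR _ d) _        = ⟨ d ⟩
    prem (natRs _ d) _       = ⟨ d ⟩
    prem (natL _ _ d e f) Fin.zero = ⟨ d ⟩
    prem (natL _ _ d e f) (Fin.suc Fin.zero) = ⟨ e ⟩
    prem (natL _ _ d e f) (Fin.suc (Fin.suc _)) = ⟨ f ⟩

    -- ht(d) ≤ ht(e), where ht(d) = lub { ht(dᵢ) + 1 } (ordinal heights):
    -- every premise of d has height < ht(e), i.e. ≤ the height of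
    -- some premise of e.
    data _⊑_ (d e : AnyProof) : Set where
      ht≤ : (∀ (i : Prem (AnyProof.der d)) →
               Σ[ j ∈ Prem (AnyProof.der e) ] (prem (AnyProof.der d) i ⊑ prem (AnyProof.der e) j)) →
            d ⊑ e

-- Substituting the names aᵢ for x everywhere in Π does not give a derivation: a rule of Π that
-- chooses a nominal constant (∇L and ∇R, the names raised over in ∀R, ∃L and eqL, the
-- permutations of idπ) may choose some aᵢ, and a term instantiated by ∀L, ∃R, natR or natL may
-- contain one.  We therefore prove, by induction on derivations, a statement in which every
-- formula B of the sequent carries its own annotation (π , a) with a ∉ supp(B) and is sent to
-- π.(Bθ)[a/x], where θ substitutes eigenvariables by terms without nominal constants.  At each
-- rule the annotations of the premises are chosen so that the images form an instance of the
-- same rule: a clashing name is exchanged for a fresh one and the exchange is absorbed into π by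
-- a transposition.  Each premise is translated by the induction hypothesis, so heights do not
-- grow; the theorem is the case in which θ is the identity and every π is the identity
-- permutation.

module Submission where

open import Defs
open import Data.Nat using (ℕ; zero; suc; pred; _≟_; _≤_; _⊔_; s≤s)
import Data.Nat.Properties as NP
open import Data.Fin using (Fin)
import Data.Fin as Fin
open import Data.List using (List; []; _∷_; _++_; map; concat; tabulate)
import Data.List.Properties as LP
open import Data.List.Membership.Propositional using (_∈_)
open import Data.List.Membership.Propositional.Properties using (∈-map⁺; ∈-map⁻; ∈-++⁺ˡ; ∈-++⁺ʳ)
open import Data.List.Relation.Unary.Any using (here; there)
open import Data.List.Relation.Unary.All as All using (All; []; _∷_)
import Data.List.Relation.Unary.All.Properties as AllP
open import Data.List.Relation.Unary.AllPairs.Core using (_∷_)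
open import Data.List.Relation.Unary.Unique.Propositional using (Unique)
import Data.List.Relation.Unary.Unique.Propositional.Properties as UP
open import Data.List.Relation.Binary.Permutation.Propositional using (_↭_)
open import Data.List.Relation.Binary.Permutation.Propositional.Properties using (↭-map-inv; All-resp-↭)
import Data.List.Relation.Binary.Permutation.Propositional.Properties as PP
open import Data.Product using (Σ-syntax; _×_; _,_; proj₁; proj₂)
open import Data.Product.Properties using (≡-dec)
open import Data.Sum using (_⊎_; inj₁; inj₂; [_,_])
open import Data.Unit using (tt)
open import Data.Empty using (⊥; ⊥-elim)
open import Relation.Nullary using (¬_; yes; no; Dec)
open import Relation.Nullary.Decidable using (_⊎-dec_)
open import Relation.Binary.PropositionalEquality hiding ([_])
open import Relation.Binary.PropositionalEquality.Properties using (subst-sym-subst)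

map-++⁻ : ∀ {A B : Set} (f : A → B) (L : List A) (xs ys : List B) → map f L ≡ xs ++ ys →
  Σ[ L₁ ∈ List A ] Σ[ L₂ ∈ List A ] (L ≡ L₁ ++ L₂) × (map f L₁ ≡ xs) × (map f L₂ ≡ ys)
map-++⁻ f L [] ys e = [] , L , refl , refl , e
map-++⁻ f (x ∷ L) (y ∷ xs) ys e with map-++⁻ f L xs ys (LP.∷-injectiveʳ e)
... | L₁ , L₂ , refl , e₁ , e₂ = x ∷ L₁ , L₂ , refl , cong₂ _∷_ (LP.∷-injectiveˡ e) e₁ , e₂

map-concat⁻ : ∀ {A B : Set} (f : A → B) (n : ℕ) (Δs : Fin n → List B) (L : List A) → map f L ≡ concat (tabulate Δs) →
  Σ[ Ls ∈ (Fin n → List A) ] (L ≡ concat (tabulate Ls)) × (∀ i → map f (Ls i) ≡ Δs i)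
map-concat⁻ f zero Δs [] e = (λ ()) , refl , λ ()
map-concat⁻ f (suc n) Δs L e with map-++⁻ f L (Δs Fin.zero) (concat (tabulate (λ i → Δs (Fin.suc i)))) e
... | L₁ , L₂ , refl , e₁ , e₂ with map-concat⁻ f n (λ i → Δs (Fin.suc i)) L₂ e₂
... | Ls , refl , eLs = (λ { Fin.zero → L₁ ; (Fin.suc i) → Ls i }) , refl , λ { Fin.zero → e₁ ; (Fin.suc i) → eLs i }

module Syntax (𝒮 : Sig) where

  open LG 𝒮

  variable
    Γ Δ Ξ Ω : Ctx
    τ σ' : Ty

  -- Simultaneous substitution for variables and nominal constants: sub, ren and permT are its
  -- instances, so all their commutation laws follow from subVN-subVN.
  NameSub : Ctx → Set
  NameSub Δ = (ι k : ℕ) → Tm Δ (nom ι)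

  extN : ∀ {Δ σ} → NameSub Δ → NameSub (σ ∷ Δ)
  extN η ι k = ren there (η ι k)

  subVN : Sub Γ Δ → NameSub Δ → Tm Γ τ → Tm Δ τ
  subVN σ η (var v)    = σ v
  subVN σ η (nomc ι k) = η ι k
  subVN σ η (con c)    = con c
  subVN σ η zc         = zc
  subVN σ η sc         = sc
  subVN σ η (lam t)    = lam (subVN (extS σ) (extN η) t)
  subVN σ η (app t u)  = app (subVN σ η t) (subVN σ η u)

  subVNs : ∀ {Ξ} → Sub Γ Δ → NameSub Δ → Tms Γ Ξ → Tms Δ Ξ
  subVNs σ η []       = []
  subVNs σ η (t ∷ ts) = subVN σ η t ∷ subVNs σ η ts

  _≗S_ : Sub Γ Δ → Sub Γ Δ → Set
  _≗S_ {Γ} σ σ' = ∀ {τ} (v : Var Γ τ) → σ v ≡ σ' v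

  _≗N_ : NameSub Δ → NameSub Δ → Set
  η ≗N η' = ∀ ι k → η ι k ≡ η' ι k

  _≗R_ : Ren Γ Δ → Ren Γ Δ → Set
  _≗R_ {Γ} ρ ρ' = ∀ {τ} (v : Var Γ τ) → ρ v ≡ ρ' v

  extR-cong : ∀ {ρ ρ' : Ren Γ Δ} → ρ ≗R ρ' → extR {σ = σ'} ρ ≗R extR ρ'
  extR-cong e here = refl
  extR-cong e (there v) = cong there (e v)

  ren-cong : ∀ {ρ ρ' : Ren Γ Δ} → ρ ≗R ρ' → (t : Tm Γ τ) → ren ρ t ≡ ren ρ' t
  ren-cong e (var v) = cong var (e v)
  ren-cong e (nomc ι k) = refl
  ren-cong e (con c) = refl
  ren-cong e zc = refl
  ren-cong e sc = refl
  ren-cong e (lam t) = cong lam (ren-cong (extR-cong e) t)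
  ren-cong e (app t u) = cong₂ app (ren-cong e t) (ren-cong e u)

  ren-ren : ∀ (ρ : Ren Δ Ξ) (ρ' : Ren Γ Δ) (t : Tm Γ τ) → ren ρ (ren ρ' t) ≡ ren (λ v → ρ (ρ' v)) t
  ren-ren ρ ρ' (var v) = refl
  ren-ren ρ ρ' (nomc ι k) = refl
  ren-ren ρ ρ' (con c) = refl
  ren-ren ρ ρ' zc = refl
  ren-ren ρ ρ' sc = refl
  ren-ren ρ ρ' (lam t) = cong lam (trans (ren-ren (extR ρ) (extR ρ') t) (ren-cong (λ { here → refl ; (there v) → refl }) t))
  ren-ren ρ ρ' (app t u) = cong₂ app (ren-ren ρ ρ' t) (ren-ren ρ ρ' u)

  extS-cong : ∀ {σ σ₂ : Sub Γ Δ} → σ ≗S σ₂ → extS {σ = σ'} σ ≗S extS σ₂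
  extS-cong e here = refl
  extS-cong e (there v) = cong (ren there) (e v)

  extN-cong : ∀ {η η' : NameSub Δ} → η ≗N η' → extN {σ = σ'} η ≗N extN η'
  extN-cong e ι k = cong (ren there) (e ι k)

  subVN-cong : ∀ {σ σ₂ : Sub Γ Δ} {η η' : NameSub Δ} → σ ≗S σ₂ → η ≗N η' → (t : Tm Γ τ) → subVN σ η t ≡ subVN σ₂ η' t
  subVN-cong es en (var v) = es v
  subVN-cong es en (nomc ι k) = en ι k
  subVN-cong es en (con c) = refl
  subVN-cong es en zc = refl
  subVN-cong es en sc = refl
  subVN-cong es en (lam t) = cong lam (subVN-cong (extS-cong es) (extN-cong en) t)
  subVN-cong es en (app t u) = cong₂ app (subVN-cong es en t) (subVN-cong es en u)

  ren-subVN : ∀ (ρ : Ren Δ Ξ) (σ : Sub Γ Δ) (η : NameSub Δ) (t : Tm Γ τ) →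
    ren ρ (subVN σ η t) ≡ subVN (λ v → ren ρ (σ v)) (λ ι k → ren ρ (η ι k)) t
  ren-subVN ρ σ η (var v) = refl
  ren-subVN ρ σ η (nomc ι k) = refl
  ren-subVN ρ σ η (con c) = refl
  ren-subVN ρ σ η zc = refl
  ren-subVN ρ σ η sc = refl
  ren-subVN ρ σ η (lam t) = cong lam (trans (ren-subVN (extR ρ) (extS σ) (extN η) t)
     (subVN-cong (λ { here → refl ; (there v) → trans (ren-ren (extR ρ) there (σ v)) (sym (ren-ren there ρ (σ v))) })
                (λ ι k → trans (ren-ren (extR ρ) there (η ι k)) (sym (ren-ren there ρ (η ι k)))) t))
  ren-subVN ρ σ η (app t u) = cong₂ app (ren-subVN ρ σ η t) (ren-subVN ρ σ η u)

  subVN-ren : ∀ (σ : Sub Δ Ξ) (η : NameSub Ξ) (ρ : Ren Γ Δ) (t : Tm Γ τ) →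
    subVN σ η (ren ρ t) ≡ subVN (λ v → σ (ρ v)) η t
  subVN-ren σ η ρ (var v) = refl
  subVN-ren σ η ρ (nomc ι k) = refl
  subVN-ren σ η ρ (con c) = refl
  subVN-ren σ η ρ zc = refl
  subVN-ren σ η ρ sc = refl
  subVN-ren σ η ρ (lam t) = cong lam (trans (subVN-ren (extS σ) (extN η) (extR ρ) t)
     (subVN-cong (λ { here → refl ; (there v) → refl }) (λ ι k → refl) t))
  subVN-ren σ η ρ (app t u) = cong₂ app (subVN-ren σ η ρ t) (subVN-ren σ η ρ u)

  subVN-wk : ∀ (σ : Sub Δ Ξ) (η : NameSub Ξ) (t : Tm Δ τ) →
    subVN (extS {σ = σ'} σ) (extN η) (ren there t) ≡ ren there (subVN σ η t)
  subVN-wk σ η t = trans (subVN-ren (extS σ) (extN η) there t) (sym (ren-subVN there σ η t))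

  subVN-subVN : ∀ (σ₁ : Sub Δ Ξ) (η₁ : NameSub Ξ) (σ₂ : Sub Γ Δ) (η₂ : NameSub Δ) (t : Tm Γ τ) →
    subVN σ₁ η₁ (subVN σ₂ η₂ t) ≡ subVN (λ v → subVN σ₁ η₁ (σ₂ v)) (λ ι k → subVN σ₁ η₁ (η₂ ι k)) t
  subVN-subVN σ₁ η₁ σ₂ η₂ (var v) = refl
  subVN-subVN σ₁ η₁ σ₂ η₂ (nomc ι k) = refl
  subVN-subVN σ₁ η₁ σ₂ η₂ (con c) = refl
  subVN-subVN σ₁ η₁ σ₂ η₂ zc = refl
  subVN-subVN σ₁ η₁ σ₂ η₂ sc = refl
  subVN-subVN σ₁ η₁ σ₂ η₂ (lam t) = cong lam (trans (subVN-subVN (extS σ₁) (extN η₁) (extS σ₂) (extN η₂) t)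
     (subVN-cong (λ { here → refl ; (there v) → subVN-wk σ₁ η₁ (σ₂ v) }) (λ ι k → subVN-wk σ₁ η₁ (η₂ ι k)) t))
  subVN-subVN σ₁ η₁ σ₂ η₂ (app t u) = cong₂ app (subVN-subVN σ₁ η₁ σ₂ η₂ t) (subVN-subVN σ₁ η₁ σ₂ η₂ u)

  sub-as-subVN : ∀ (σ : Sub Γ Δ) (t : Tm Γ τ) → sub σ t ≡ subVN σ nomc t
  sub-as-subVN σ (var v) = refl
  sub-as-subVN σ (nomc ι k) = refl
  sub-as-subVN σ (con c) = refl
  sub-as-subVN σ zc = refl
  sub-as-subVN σ sc = refl
  sub-as-subVN σ (lam t) = cong lam (sub-as-subVN (extS σ) t)
  sub-as-subVN σ (app t u) = cong₂ app (sub-as-subVN σ t) (sub-as-subVN σ u)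

  ren-as-subVN : ∀ (ρ : Ren Γ Δ) (t : Tm Γ τ) → ren ρ t ≡ subVN (λ v → var (ρ v)) nomc t
  ren-as-subVN ρ (var v) = refl
  ren-as-subVN ρ (nomc ι k) = refl
  ren-as-subVN ρ (con c) = refl
  ren-as-subVN ρ zc = refl
  ren-as-subVN ρ sc = refl
  ren-as-subVN ρ (lam t) = cong lam (trans (ren-as-subVN (extR ρ) t) (subVN-cong (λ { here → refl ; (there v) → refl }) (λ ι k → refl) t))
  ren-as-subVN ρ (app t u) = cong₂ app (ren-as-subVN ρ t) (ren-as-subVN ρ u)

  extS-var : extS {Γ} {Γ} {σ'} var ≗S var
  extS-var here = refl
  extS-var (there v) = refl

  subVN-id : ∀ (t : Tm Γ τ) → subVN var nomc t ≡ t
  subVN-id (var v) = refl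
  subVN-id (nomc ι k) = refl
  subVN-id (con c) = refl
  subVN-id zc = refl
  subVN-id sc = refl
  subVN-id (lam t) = cong lam (trans (subVN-cong extS-var (λ _ _ → refl) t) (subVN-id t))
  subVN-id (app t u) = cong₂ app (subVN-id t) (subVN-id u)

  subVNs-cong : ∀ {Ξ} {σ σ₂ : Sub Γ Δ} {η η' : NameSub Δ} → σ ≗S σ₂ → η ≗N η' → (ts : Tms Γ Ξ) → subVNs σ η ts ≡ subVNs σ₂ η' ts
  subVNs-cong es en [] = refl
  subVNs-cong es en (t ∷ ts) = cong₂ _∷_ (subVN-cong es en t) (subVNs-cong es en ts)

  subVNs-subVNs : ∀ {Ω} (σ₁ : Sub Δ Ξ) (η₁ : NameSub Ξ) (σ₂ : Sub Γ Δ) (η₂ : NameSub Δ) (ts : Tms Γ Ω) →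
    subVNs σ₁ η₁ (subVNs σ₂ η₂ ts) ≡ subVNs (λ v → subVN σ₁ η₁ (σ₂ v)) (λ ι k → subVN σ₁ η₁ (η₂ ι k)) ts
  subVNs-subVNs σ₁ η₁ σ₂ η₂ [] = refl
  subVNs-subVNs σ₁ η₁ σ₂ η₂ (t ∷ ts) = cong₂ _∷_ (subVN-subVN σ₁ η₁ σ₂ η₂ t) (subVNs-subVNs σ₁ η₁ σ₂ η₂ ts)

  subTs-as-subVN : ∀ {Ω} (σ : Sub Γ Δ) (ts : Tms Γ Ω) → subTs σ ts ≡ subVNs σ nomc ts
  subTs-as-subVN σ [] = refl
  subTs-as-subVN σ (t ∷ ts) = cong₂ _∷_ (sub-as-subVN σ t) (subTs-as-subVN σ ts)

  renTs-as-subVN : ∀ {Ω} (ρ : Ren Γ Δ) (ts : Tms Γ Ω) → renTs ρ ts ≡ subVNs (λ v → var (ρ v)) nomc ts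
  renTs-as-subVN ρ [] = refl
  renTs-as-subVN ρ (t ∷ ts) = cong₂ _∷_ (ren-as-subVN ρ t) (renTs-as-subVN ρ ts)

  subVNF : Sub Γ Δ → NameSub Δ → Fm Γ → Fm Δ
  subVNF σ η top = top
  subVNF σ η bot = bot
  subVNF σ η (B and C) = subVNF σ η B and subVNF σ η C
  subVNF σ η (B or C) = subVNF σ η B or subVNF σ η C
  subVNF σ η (B imp C) = subVNF σ η B imp subVNF σ η C
  subVNF σ η (all τ B) = all τ (subVNF (extS σ) (extN η) B)
  subVNF σ η (ex τ B) = ex τ (subVNF (extS σ) (extN η) B)
  subVNF σ η (nab ι B) = nab ι (subVNF (extS σ) (extN η) B)
  subVNF σ η (eq τ s t) = eq τ (subVN σ η s) (subVN σ η t)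
  subVNF σ η (nat t) = nat (subVN σ η t)
  subVNF σ η (atm p ts) = atm p (subVNs σ η ts)

  subVNF-cong : ∀ {σ σ₂ : Sub Γ Δ} {η η' : NameSub Δ} → σ ≗S σ₂ → η ≗N η' → (B : Fm Γ) → subVNF σ η B ≡ subVNF σ₂ η' B
  subVNF-cong es en top = refl
  subVNF-cong es en bot = refl
  subVNF-cong es en (B and C) = cong₂ _and_ (subVNF-cong es en B) (subVNF-cong es en C)
  subVNF-cong es en (B or C) = cong₂ _or_ (subVNF-cong es en B) (subVNF-cong es en C)
  subVNF-cong es en (B imp C) = cong₂ _imp_ (subVNF-cong es en B) (subVNF-cong es en C)
  subVNF-cong es en (all τ B) = cong (all τ) (subVNF-cong (extS-cong es) (extN-cong en) B)
  subVNF-cong es en (ex τ B) = cong (ex τ) (subVNF-cong (extS-cong es) (extN-cong en) B)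
  subVNF-cong es en (nab ι B) = cong (nab ι) (subVNF-cong (extS-cong es) (extN-cong en) B)
  subVNF-cong es en (eq τ s t) = cong₂ (eq τ) (subVN-cong es en s) (subVN-cong es en t)
  subVNF-cong es en (nat t) = cong nat (subVN-cong es en t)
  subVNF-cong es en (atm p ts) = cong (atm p) (subVNs-cong es en ts)

  subVNF-subVNF : ∀ (σ₁ : Sub Δ Ξ) (η₁ : NameSub Ξ) (σ₂ : Sub Γ Δ) (η₂ : NameSub Δ) (B : Fm Γ) →
    subVNF σ₁ η₁ (subVNF σ₂ η₂ B) ≡ subVNF (λ v → subVN σ₁ η₁ (σ₂ v)) (λ ι k → subVN σ₁ η₁ (η₂ ι k)) B
  subVNF-subVNF σ₁ η₁ σ₂ η₂ top = refl
  subVNF-subVNF σ₁ η₁ σ₂ η₂ bot = refl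
  subVNF-subVNF σ₁ η₁ σ₂ η₂ (B and C) = cong₂ _and_ (subVNF-subVNF σ₁ η₁ σ₂ η₂ B) (subVNF-subVNF σ₁ η₁ σ₂ η₂ C)
  subVNF-subVNF σ₁ η₁ σ₂ η₂ (B or C) = cong₂ _or_ (subVNF-subVNF σ₁ η₁ σ₂ η₂ B) (subVNF-subVNF σ₁ η₁ σ₂ η₂ C)
  subVNF-subVNF σ₁ η₁ σ₂ η₂ (B imp C) = cong₂ _imp_ (subVNF-subVNF σ₁ η₁ σ₂ η₂ B) (subVNF-subVNF σ₁ η₁ σ₂ η₂ C)
  subVNF-subVNF σ₁ η₁ σ₂ η₂ (all τ B) = cong (all τ) (trans (subVNF-subVNF (extS σ₁) (extN η₁) (extS σ₂) (extN η₂) B)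
     (subVNF-cong (λ { here → refl ; (there v) → subVN-wk σ₁ η₁ (σ₂ v) }) (λ ι k → subVN-wk σ₁ η₁ (η₂ ι k)) B))
  subVNF-subVNF σ₁ η₁ σ₂ η₂ (ex τ B) = cong (ex τ) (trans (subVNF-subVNF (extS σ₁) (extN η₁) (extS σ₂) (extN η₂) B)
     (subVNF-cong (λ { here → refl ; (there v) → subVN-wk σ₁ η₁ (σ₂ v) }) (λ ι k → subVN-wk σ₁ η₁ (η₂ ι k)) B))
  subVNF-subVNF σ₁ η₁ σ₂ η₂ (nab ι B) = cong (nab ι) (trans (subVNF-subVNF (extS σ₁) (extN η₁) (extS σ₂) (extN η₂) B)
     (subVNF-cong (λ { here → refl ; (there v) → subVN-wk σ₁ η₁ (σ₂ v) }) (λ ι k → subVN-wk σ₁ η₁ (η₂ ι k)) B))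
  subVNF-subVNF σ₁ η₁ σ₂ η₂ (eq τ s t) = cong₂ (eq τ) (subVN-subVN σ₁ η₁ σ₂ η₂ s) (subVN-subVN σ₁ η₁ σ₂ η₂ t)
  subVNF-subVNF σ₁ η₁ σ₂ η₂ (nat t) = cong nat (subVN-subVN σ₁ η₁ σ₂ η₂ t)
  subVNF-subVNF σ₁ η₁ σ₂ η₂ (atm p ts) = cong (atm p) (subVNs-subVNs σ₁ η₁ σ₂ η₂ ts)

  subF-as-subVN : ∀ (σ : Sub Γ Δ) (B : Fm Γ) → subF σ B ≡ subVNF σ nomc B
  subF-as-subVN σ top = refl
  subF-as-subVN σ bot = refl
  subF-as-subVN σ (B and C) = cong₂ _and_ (subF-as-subVN σ B) (subF-as-subVN σ C)
  subF-as-subVN σ (B or C) = cong₂ _or_ (subF-as-subVN σ B) (subF-as-subVN σ C)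
  subF-as-subVN σ (B imp C) = cong₂ _imp_ (subF-as-subVN σ B) (subF-as-subVN σ C)
  subF-as-subVN σ (all τ B) = cong (all τ) (subF-as-subVN (extS σ) B)
  subF-as-subVN σ (ex τ B) = cong (ex τ) (subF-as-subVN (extS σ) B)
  subF-as-subVN σ (nab ι B) = cong (nab ι) (subF-as-subVN (extS σ) B)
  subF-as-subVN σ (eq τ s t) = cong₂ (eq τ) (sub-as-subVN σ s) (sub-as-subVN σ t)
  subF-as-subVN σ (nat t) = cong nat (sub-as-subVN σ t)
  subF-as-subVN σ (atm p ts) = cong (atm p) (subTs-as-subVN σ ts)

  extvar : ∀ (ρ : Ren Γ Δ) → (λ {τ} v → var {τ = τ} (extR {σ = σ'} ρ v)) ≗S extS (λ v → var (ρ v))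
  extvar ρ here = refl
  extvar ρ (there v) = refl

  renF-as-subVN : ∀ (ρ : Ren Γ Δ) (B : Fm Γ) → renF ρ B ≡ subVNF (λ v → var (ρ v)) nomc B
  renF-as-subVN ρ top = refl
  renF-as-subVN ρ bot = refl
  renF-as-subVN ρ (B and C) = cong₂ _and_ (renF-as-subVN ρ B) (renF-as-subVN ρ C)
  renF-as-subVN ρ (B or C) = cong₂ _or_ (renF-as-subVN ρ B) (renF-as-subVN ρ C)
  renF-as-subVN ρ (B imp C) = cong₂ _imp_ (renF-as-subVN ρ B) (renF-as-subVN ρ C)
  renF-as-subVN ρ (all τ B) = cong (all τ) (trans (renF-as-subVN (extR ρ) B) (subVNF-cong (extvar ρ) (λ ι k → refl) B))
  renF-as-subVN ρ (ex τ B) = cong (ex τ) (trans (renF-as-subVN (extR ρ) B) (subVNF-cong (extvar ρ) (λ ι k → refl) B))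
  renF-as-subVN ρ (nab ι B) = cong (nab ι) (trans (renF-as-subVN (extR ρ) B) (subVNF-cong (extvar ρ) (λ ι k → refl) B))
  renF-as-subVN ρ (eq τ s t) = cong₂ (eq τ) (ren-as-subVN ρ s) (ren-as-subVN ρ t)
  renF-as-subVN ρ (nat t) = cong nat (ren-as-subVN ρ t)
  renF-as-subVN ρ (atm p ts) = cong (atm p) (renTs-as-subVN ρ ts)

  subVNs-id : ∀ {Ξ} (ts : Tms Γ Ξ) → subVNs var nomc ts ≡ ts
  subVNs-id [] = refl
  subVNs-id (t ∷ ts) = cong₂ _∷_ (subVN-id t) (subVNs-id ts)

  subVNF-id : ∀ (B : Fm Γ) → subVNF var nomc B ≡ B
  subVNF-id top = refl
  subVNF-id bot = refl
  subVNF-id (B and C) = cong₂ _and_ (subVNF-id B) (subVNF-id C)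
  subVNF-id (B or C) = cong₂ _or_ (subVNF-id B) (subVNF-id C)
  subVNF-id (B imp C) = cong₂ _imp_ (subVNF-id B) (subVNF-id C)
  subVNF-id (all τ B) = cong (all τ) (trans (subVNF-cong extS-var (λ _ _ → refl) B) (subVNF-id B))
  subVNF-id (ex τ B) = cong (ex τ) (trans (subVNF-cong extS-var (λ _ _ → refl) B) (subVNF-id B))
  subVNF-id (nab ι B) = cong (nab ι) (trans (subVNF-cong extS-var (λ _ _ → refl) B) (subVNF-id B))
  subVNF-id (eq τ s t) = cong₂ (eq τ) (subVN-id s) (subVN-id t)
  subVNF-id (nat t) = cong nat (subVN-id t)
  subVNF-id (atm p ts) = cong (atm p) (subVNs-id ts)

  subF-id : ∀ (B : Fm Γ) → subF var B ≡ B
  subF-id B = trans (subF-as-subVN var B) (subVNF-id B)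

  permNames : ∀ {Δ} → Perm → NameSub Δ
  permNames π ι k = nomc ι (Perm.f π ι k)

  permT-as-subVN : ∀ (π : Perm) (t : Tm Γ τ) → permT π t ≡ subVN var (permNames π) t
  permT-as-subVN π (var v) = refl
  permT-as-subVN π (nomc ι k) = refl
  permT-as-subVN π (con c) = refl
  permT-as-subVN π zc = refl
  permT-as-subVN π sc = refl
  permT-as-subVN π (lam t) = cong lam (trans (permT-as-subVN π t) (subVN-cong (λ { here → refl ; (there v) → refl }) (λ ι k → refl) t))
  permT-as-subVN π (app t u) = cong₂ app (permT-as-subVN π t) (permT-as-subVN π u)

  permTs-as-subVN : ∀ {Ω} (π : Perm) (ts : Tms Γ Ω) → permTs π ts ≡ subVNs var (permNames π) ts
  permTs-as-subVN π [] = refl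
  permTs-as-subVN π (t ∷ ts) = cong₂ _∷_ (permT-as-subVN π t) (permTs-as-subVN π ts)

  permF-as-subVN : ∀ (π : Perm) (B : Fm Γ) → permF π B ≡ subVNF var (permNames π) B
  permF-as-subVN π top = refl
  permF-as-subVN π bot = refl
  permF-as-subVN π (B and C) = cong₂ _and_ (permF-as-subVN π B) (permF-as-subVN π C)
  permF-as-subVN π (B or C) = cong₂ _or_ (permF-as-subVN π B) (permF-as-subVN π C)
  permF-as-subVN π (B imp C) = cong₂ _imp_ (permF-as-subVN π B) (permF-as-subVN π C)
  permF-as-subVN π (all τ B) = cong (all τ) (trans (permF-as-subVN π B) (subVNF-cong (λ { here → refl ; (there v) → refl }) (λ ι k → refl) B))
  permF-as-subVN π (ex τ B) = cong (ex τ) (trans (permF-as-subVN π B) (subVNF-cong (λ { here → refl ; (there v) → refl }) (λ ι k → refl) B))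
  permF-as-subVN π (nab ι B) = cong (nab ι) (trans (permF-as-subVN π B) (subVNF-cong (λ { here → refl ; (there v) → refl }) (λ ι k → refl) B))
  permF-as-subVN π (eq τ s t) = cong₂ (eq τ) (permT-as-subVN π s) (permT-as-subVN π t)
  permF-as-subVN π (nat t) = cong nat (permT-as-subVN π t)
  permF-as-subVN π (atm p ts) = cong (atm p) (permTs-as-subVN π ts)

  nameToVar : ∀ {Δ} (ι k : ℕ) → Var Δ (nom ι) → NameSub Δ
  nameToVar ι k x ι' k' with ι ≟ ι' | k ≟ k'
  ... | yes refl | yes refl = var x
  ... | _        | _        = nomc ι' k'

  nameToVar-ext : ∀ {Δ σ} (ι k : ℕ) (x : Var Δ (nom ι)) → extN {σ = σ} (nameToVar ι k x) ≗N nameToVar ι k (there x)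
  nameToVar-ext ι k x ι' k' with ι ≟ ι' | k ≟ k'
  ... | yes refl | yes refl = refl
  ... | yes refl | no _ = refl
  ... | no _ | _ = refl

  absAt-as-subVN : ∀ (ι k : ℕ) (ρ : Ren Γ Δ) (x : Var Δ (nom ι)) (t : Tm Γ τ) → absAt ι k ρ x t ≡ subVN (λ v → var (ρ v)) (nameToVar ι k x) t
  absAt-as-subVN ι k ρ x (var v) = refl
  absAt-as-subVN ι k ρ x (nomc ι' k') with ι ≟ ι' | k ≟ k'
  ... | yes refl | yes refl = refl
  ... | yes refl | no _ = refl
  ... | no _ | _ = refl
  absAt-as-subVN ι k ρ x (con c) = refl
  absAt-as-subVN ι k ρ x zc = refl
  absAt-as-subVN ι k ρ x sc = refl
  absAt-as-subVN ι k ρ x (lam t) = cong lam (trans (absAt-as-subVN ι k (extR ρ) (there x) t) (subVN-cong (λ { here → refl ; (there v) → refl }) (λ ι' k' → sym (nameToVar-ext ι k x ι' k')) t))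
  absAt-as-subVN ι k ρ x (app t u) = cong₂ app (absAt-as-subVN ι k ρ x t) (absAt-as-subVN ι k ρ x u)

  -- Support and freshness

  _≟N_ : (a b : NomC) → Dec (a ≡ b)
  _≟N_ = ≡-dec _≟_ _≟_

  occ-ren⁻ : ∀ {Γ Δ τ} b (ρ : Ren Γ Δ) (t : Tm Γ τ) → occT b (ren ρ t) → occT b t
  occ-ren⁻ b ρ (nomc ι k) o = o
  occ-ren⁻ b ρ (lam t) o = occ-ren⁻ b (extR ρ) t o
  occ-ren⁻ b ρ (app t u) (inj₁ o) = inj₁ (occ-ren⁻ b ρ t o)
  occ-ren⁻ b ρ (app t u) (inj₂ o) = inj₂ (occ-ren⁻ b ρ u o)

  occ-ren⁺ : ∀ {Γ Δ τ} b (ρ : Ren Γ Δ) (t : Tm Γ τ) → occT b t → occT b (ren ρ t)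
  occ-ren⁺ b ρ (nomc ι k) o = o
  occ-ren⁺ b ρ (lam t) o = occ-ren⁺ b (extR ρ) t o
  occ-ren⁺ b ρ (app t u) (inj₁ o) = inj₁ (occ-ren⁺ b ρ t o)
  occ-ren⁺ b ρ (app t u) (inj₂ o) = inj₂ (occ-ren⁺ b ρ u o)

  OccSource : ∀ {Γ Δ} → NomC → Sub Γ Δ → NameSub Δ → (NomC → Set) → Set
  OccSource {Γ} b σ η O = (Σ[ τ ∈ Ty ] Σ[ v ∈ Var Γ τ ] occT b (σ v)) ⊎ (Σ[ ι ∈ ℕ ] Σ[ k ∈ ℕ ] (O (ι , k) × occT b (η ι k)))

  occ-subVN⁻ : ∀ {Γ Δ τ} b (σ : Sub Γ Δ) (η : NameSub Δ) (t : Tm Γ τ) → occT b (subVN σ η t) → OccSource b σ η (λ c → occT c t)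
  occ-subVN⁻ b σ η (var v) o = inj₁ (_ , v , o)
  occ-subVN⁻ b σ η (nomc ι k) o = inj₂ (ι , k , refl , o)
  occ-subVN⁻ b σ η (lam t) o with occ-subVN⁻ b (extS σ) (extN η) t o
  ... | inj₁ (τ , there v , o') = inj₁ (τ , v , occ-ren⁻ b there (σ v) o')
  ... | inj₂ (ι , k , oc , o') = inj₂ (ι , k , oc , occ-ren⁻ b there (η ι k) o')
  occ-subVN⁻ b σ η (app t u) (inj₁ o) with occ-subVN⁻ b σ η t o
  ... | inj₁ x = inj₁ x
  ... | inj₂ (ι , k , oc , o') = inj₂ (ι , k , inj₁ oc , o')
  occ-subVN⁻ b σ η (app t u) (inj₂ o) with occ-subVN⁻ b σ η u o
  ... | inj₁ x = inj₁ x
  ... | inj₂ (ι , k , oc , o') = inj₂ (ι , k , inj₂ oc , o')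

  occ-subVN⁺ : ∀ {Γ Δ τ} b (σ : Sub Γ Δ) (η : NameSub Δ) (t : Tm Γ τ) ι k → occT (ι , k) t → occT b (η ι k) → occT b (subVN σ η t)
  occ-subVN⁺ b σ η (nomc ι k) .ι .k refl o = o
  occ-subVN⁺ b σ η (lam t) ι k oc o = occ-subVN⁺ b (extS σ) (extN η) t ι k oc (occ-ren⁺ b there (η ι k) o)
  occ-subVN⁺ b σ η (app t u) ι k (inj₁ oc) o = inj₁ (occ-subVN⁺ b σ η t ι k oc o)
  occ-subVN⁺ b σ η (app t u) ι k (inj₂ oc) o = inj₂ (occ-subVN⁺ b σ η u ι k oc o)

  varIndex : ∀ {Γ τ} → Var Γ τ → ℕ
  varIndex here = zero
  varIndex (there v) = suc (varIndex v)

  voccT : ∀ {Γ τ} → ℕ → Tm Γ τ → Set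
  voccT n (var v) = varIndex v ≡ n
  voccT n (nomc ι k) = ⊥
  voccT n (con c) = ⊥
  voccT n zc = ⊥
  voccT n sc = ⊥
  voccT n (lam t) = voccT (suc n) t
  voccT n (app t u) = voccT n t ⊎ voccT n u

  subVN-cong-occ : ∀ {Γ Δ τ} {σ σ₂ : Sub Γ Δ} {η η' : NameSub Δ} (t : Tm Γ τ) →
    (∀ {τ'} (v : Var Γ τ') → voccT (varIndex v) t → σ v ≡ σ₂ v) →
    (∀ ι k → occT (ι , k) t → η ι k ≡ η' ι k) → subVN σ η t ≡ subVN σ₂ η' t
  subVN-cong-occ (var v) es en = es v refl
  subVN-cong-occ (nomc ι k) es en = en ι k refl
  subVN-cong-occ (con c) es en = refl
  subVN-cong-occ zc es en = refl
  subVN-cong-occ sc es en = refl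
  subVN-cong-occ {σ = σ} {σ₂} {η} {η'} (lam t) es en = cong lam (subVN-cong-occ t
    (λ { here o → refl ; (there v) o → cong (ren there) (es v o) }) (λ ι k o → cong (ren there) (en ι k o)))
  subVN-cong-occ (app t u) es en = cong₂ app (subVN-cong-occ t (λ v o → es v (inj₁ o)) (λ ι k o → en ι k (inj₁ o)))
                                            (subVN-cong-occ u (λ v o → es v (inj₂ o)) (λ ι k o → en ι k (inj₂ o)))

  varIndex-transport : ∀ {Γ τ τ'} (v' : Var Γ τ) (v : Var Γ τ') → varIndex v' ≡ varIndex v → (P : ∀ {τ} → Var Γ τ → Set) → P v → P v'
  varIndex-transport here here e P p = p
  varIndex-transport (there v') (there v) e P p = varIndex-transport v' v (cong pred e) (λ w → P (there w)) p
  varIndex-transport here (there v) () P p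
  varIndex-transport (there v') here () P p

  occ-vocc : ∀ {Γ Δ τ τ'} b (σ : Sub Γ Δ) (η : NameSub Δ) (t : Tm Γ τ) (v : Var Γ τ') → voccT (varIndex v) t → occT b (σ v) → occT b (subVN σ η t)
  occ-vocc b σ η (var v') v o o' = varIndex-transport v' v o (λ w → occT b (σ w)) o'

  occ-vocc b σ η (lam t) v o o' = occ-vocc b (extS σ) (extN η) t (there v) o (occ-ren⁺ b there (σ v) o')
  occ-vocc b σ η (app t u) v (inj₁ o) o' = inj₁ (occ-vocc b σ η t v o o')
  occ-vocc b σ η (app t u) v (inj₂ o) o' = inj₂ (occ-vocc b σ η u v o o')

  occTs-subVN⁻ : ∀ {Γ Δ Ξ} b (σ : Sub Γ Δ) (η : NameSub Δ) (ts : Tms Γ Ξ) → occTs b (subVNs σ η ts) → OccSource b σ η (λ c → occTs c ts)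
  occTs-subVN⁻ b σ η (t ∷ ts) (inj₁ o) with occ-subVN⁻ b σ η t o
  ... | inj₁ x = inj₁ x
  ... | inj₂ (ι , k , oc , o') = inj₂ (ι , k , inj₁ oc , o')
  occTs-subVN⁻ b σ η (t ∷ ts) (inj₂ o) with occTs-subVN⁻ b σ η ts o
  ... | inj₁ x = inj₁ x
  ... | inj₂ (ι , k , oc , o') = inj₂ (ι , k , inj₂ oc , o')

  occTs-subVN⁺ : ∀ {Γ Δ Ξ} b (σ : Sub Γ Δ) (η : NameSub Δ) (ts : Tms Γ Ξ) ι k → occTs (ι , k) ts → occT b (η ι k) → occTs b (subVNs σ η ts)
  occTs-subVN⁺ b σ η (t ∷ ts) ι k (inj₁ oc) o = inj₁ (occ-subVN⁺ b σ η t ι k oc o)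
  occTs-subVN⁺ b σ η (t ∷ ts) ι k (inj₂ oc) o = inj₂ (occTs-subVN⁺ b σ η ts ι k oc o)

  voccTs : ∀ {Γ Ξ} → ℕ → Tms Γ Ξ → Set
  voccTs n [] = ⊥
  voccTs n (t ∷ ts) = voccT n t ⊎ voccTs n ts

  subVNs-cong-occ : ∀ {Γ Δ Ξ} {σ σ₂ : Sub Γ Δ} {η η' : NameSub Δ} (ts : Tms Γ Ξ) →
    (∀ {τ'} (v : Var Γ τ') → voccTs (varIndex v) ts → σ v ≡ σ₂ v) →
    (∀ ι k → occTs (ι , k) ts → η ι k ≡ η' ι k) → subVNs σ η ts ≡ subVNs σ₂ η' ts
  subVNs-cong-occ [] es en = refl
  subVNs-cong-occ (t ∷ ts) es en = cong₂ _∷_ (subVN-cong-occ t (λ v o → es v (inj₁ o)) (λ ι k o → en ι k (inj₁ o)))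
                                              (subVNs-cong-occ ts (λ v o → es v (inj₂ o)) (λ ι k o → en ι k (inj₂ o)))

  OccSource-ext : ∀ {Γ Δ σ₀} b (σ : Sub Γ Δ) (η : NameSub Δ) {O : NomC → Set} → OccSource b (extS {σ = σ₀} σ) (extN η) O → OccSource b σ η O
  OccSource-ext b σ η (inj₁ (τ , there v , o')) = inj₁ (τ , v , occ-ren⁻ b there (σ v) o')
  OccSource-ext b σ η (inj₂ (ι , k , oc , o')) = inj₂ (ι , k , oc , occ-ren⁻ b there (η ι k) o')

  OccSource-map : ∀ {Γ Δ} b (σ : Sub Γ Δ) (η : NameSub Δ) {O O' : NomC → Set} → (∀ c → O c → O' c) → OccSource b σ η O → OccSource b σ η O'
  OccSource-map b σ η f (inj₁ x) = inj₁ x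
  OccSource-map b σ η f (inj₂ (ι , k , oc , o)) = inj₂ (ι , k , f _ oc , o)

  occF-subVN⁻ : ∀ {Γ Δ} b (σ : Sub Γ Δ) (η : NameSub Δ) (B : Fm Γ) → occF b (subVNF σ η B) → OccSource b σ η (λ c → occF c B)
  occF-subVN⁻ b σ η (B and C) (inj₁ o) = OccSource-map b σ η (λ c → inj₁) (occF-subVN⁻ b σ η B o)
  occF-subVN⁻ b σ η (B and C) (inj₂ o) = OccSource-map b σ η (λ c → inj₂) (occF-subVN⁻ b σ η C o)
  occF-subVN⁻ b σ η (B or C) (inj₁ o) = OccSource-map b σ η (λ c → inj₁) (occF-subVN⁻ b σ η B o)
  occF-subVN⁻ b σ η (B or C) (inj₂ o) = OccSource-map b σ η (λ c → inj₂) (occF-subVN⁻ b σ η C o)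
  occF-subVN⁻ b σ η (B imp C) (inj₁ o) = OccSource-map b σ η (λ c → inj₁) (occF-subVN⁻ b σ η B o)
  occF-subVN⁻ b σ η (B imp C) (inj₂ o) = OccSource-map b σ η (λ c → inj₂) (occF-subVN⁻ b σ η C o)
  occF-subVN⁻ b σ η (all τ B) o = OccSource-ext b σ η (occF-subVN⁻ b (extS σ) (extN η) B o)
  occF-subVN⁻ b σ η (ex τ B) o = OccSource-ext b σ η (occF-subVN⁻ b (extS σ) (extN η) B o)
  occF-subVN⁻ b σ η (nab ι B) o = OccSource-ext b σ η (occF-subVN⁻ b (extS σ) (extN η) B o)
  occF-subVN⁻ b σ η (eq τ s t) (inj₁ o) = OccSource-map b σ η (λ c → inj₁) (occ-subVN⁻ b σ η s o)
  occF-subVN⁻ b σ η (eq τ s t) (inj₂ o) = OccSource-map b σ η (λ c → inj₂) (occ-subVN⁻ b σ η t o)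
  occF-subVN⁻ b σ η (nat t) o = occ-subVN⁻ b σ η t o
  occF-subVN⁻ b σ η (atm p ts) o = occTs-subVN⁻ b σ η ts o

  occF-subVN⁺ : ∀ {Γ Δ} b (σ : Sub Γ Δ) (η : NameSub Δ) (B : Fm Γ) ι k → occF (ι , k) B → occT b (η ι k) → occF b (subVNF σ η B)
  occF-subVN⁺ b σ η (B and C) ι k (inj₁ oc) o = inj₁ (occF-subVN⁺ b σ η B ι k oc o)
  occF-subVN⁺ b σ η (B and C) ι k (inj₂ oc) o = inj₂ (occF-subVN⁺ b σ η C ι k oc o)
  occF-subVN⁺ b σ η (B or C) ι k (inj₁ oc) o = inj₁ (occF-subVN⁺ b σ η B ι k oc o)
  occF-subVN⁺ b σ η (B or C) ι k (inj₂ oc) o = inj₂ (occF-subVN⁺ b σ η C ι k oc o)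
  occF-subVN⁺ b σ η (B imp C) ι k (inj₁ oc) o = inj₁ (occF-subVN⁺ b σ η B ι k oc o)
  occF-subVN⁺ b σ η (B imp C) ι k (inj₂ oc) o = inj₂ (occF-subVN⁺ b σ η C ι k oc o)
  occF-subVN⁺ b σ η (all τ B) ι k oc o = occF-subVN⁺ b (extS σ) (extN η) B ι k oc (occ-ren⁺ b there (η ι k) o)
  occF-subVN⁺ b σ η (ex τ B) ι k oc o = occF-subVN⁺ b (extS σ) (extN η) B ι k oc (occ-ren⁺ b there (η ι k) o)
  occF-subVN⁺ b σ η (nab ι' B) ι k oc o = occF-subVN⁺ b (extS σ) (extN η) B ι k oc (occ-ren⁺ b there (η ι k) o)
  occF-subVN⁺ b σ η (eq τ s t) ι k (inj₁ oc) o = inj₁ (occ-subVN⁺ b σ η s ι k oc o)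
  occF-subVN⁺ b σ η (eq τ s t) ι k (inj₂ oc) o = inj₂ (occ-subVN⁺ b σ η t ι k oc o)
  occF-subVN⁺ b σ η (nat t) ι k oc o = occ-subVN⁺ b σ η t ι k oc o
  occF-subVN⁺ b σ η (atm p ts) ι k oc o = occTs-subVN⁺ b σ η ts ι k oc o

  voccF : ∀ {Γ} → ℕ → Fm Γ → Set
  voccF n top = ⊥
  voccF n bot = ⊥
  voccF n (B and C) = voccF n B ⊎ voccF n C
  voccF n (B or C) = voccF n B ⊎ voccF n C
  voccF n (B imp C) = voccF n B ⊎ voccF n C
  voccF n (all τ B) = voccF (suc n) B
  voccF n (ex τ B) = voccF (suc n) B
  voccF n (nab ι B) = voccF (suc n) B
  voccF n (eq τ s t) = voccT n s ⊎ voccT n t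
  voccF n (nat t) = voccT n t
  voccF n (atm p ts) = voccTs n ts

  subVNF-cong-occ : ∀ {Γ Δ} {σ σ₂ : Sub Γ Δ} {η η' : NameSub Δ} (B : Fm Γ) →
    (∀ {τ'} (v : Var Γ τ') → voccF (varIndex v) B → σ v ≡ σ₂ v) →
    (∀ ι k → occF (ι , k) B → η ι k ≡ η' ι k) → subVNF σ η B ≡ subVNF σ₂ η' B
  subVNF-cong-occ top es en = refl
  subVNF-cong-occ bot es en = refl
  subVNF-cong-occ (B and C) es en = cong₂ _and_ (subVNF-cong-occ B (λ v o → es v (inj₁ o)) (λ ι k o → en ι k (inj₁ o))) (subVNF-cong-occ C (λ v o → es v (inj₂ o)) (λ ι k o → en ι k (inj₂ o)))
  subVNF-cong-occ (B or C) es en = cong₂ _or_ (subVNF-cong-occ B (λ v o → es v (inj₁ o)) (λ ι k o → en ι k (inj₁ o))) (subVNF-cong-occ C (λ v o → es v (inj₂ o)) (λ ι k o → en ι k (inj₂ o)))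
  subVNF-cong-occ (B imp C) es en = cong₂ _imp_ (subVNF-cong-occ B (λ v o → es v (inj₁ o)) (λ ι k o → en ι k (inj₁ o))) (subVNF-cong-occ C (λ v o → es v (inj₂ o)) (λ ι k o → en ι k (inj₂ o)))
  subVNF-cong-occ (all τ B) es en = cong (all τ) (subVNF-cong-occ B (λ { here o → refl ; (there v) o → cong (ren there) (es v o) }) (λ ι k o → cong (ren there) (en ι k o)))
  subVNF-cong-occ (ex τ B) es en = cong (ex τ) (subVNF-cong-occ B (λ { here o → refl ; (there v) o → cong (ren there) (es v o) }) (λ ι k o → cong (ren there) (en ι k o)))
  subVNF-cong-occ (nab ι B) es en = cong (nab ι) (subVNF-cong-occ B (λ { here o → refl ; (there v) o → cong (ren there) (es v o) }) (λ ι k o → cong (ren there) (en ι k o)))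
  subVNF-cong-occ (eq τ s t) es en = cong₂ (eq τ) (subVN-cong-occ s (λ v o → es v (inj₁ o)) (λ ι k o → en ι k (inj₁ o))) (subVN-cong-occ t (λ v o → es v (inj₂ o)) (λ ι k o → en ι k (inj₂ o)))
  subVNF-cong-occ (nat t) es en = cong nat (subVN-cong-occ t es en)
  subVNF-cong-occ (atm p ts) es en = cong (atm p) (subVNs-cong-occ ts es en)

  occT? : ∀ {Γ τ} b (t : Tm Γ τ) → Dec (occT b t)
  occT? b (var v) = no (λ ())
  occT? b (nomc ι k) = (ι , k) ≟N b
  occT? b (con c) = no (λ ())
  occT? b zc = no (λ ())
  occT? b sc = no (λ ())
  occT? b (lam t) = occT? b t
  occT? b (app t u) = occT? b t ⊎-dec occT? b u

  occTs? : ∀ {Γ Ξ} b (ts : Tms Γ Ξ) → Dec (occTs b ts)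
  occTs? b [] = no (λ ())
  occTs? b (t ∷ ts) = occT? b t ⊎-dec occTs? b ts

  occF? : ∀ {Γ} b (B : Fm Γ) → Dec (occF b B)
  occF? b top = no (λ ())
  occF? b bot = no (λ ())
  occF? b (B and C) = occF? b B ⊎-dec occF? b C
  occF? b (B or C) = occF? b B ⊎-dec occF? b C
  occF? b (B imp C) = occF? b B ⊎-dec occF? b C
  occF? b (all τ B) = occF? b B
  occF? b (ex τ B) = occF? b B
  occF? b (nab ι B) = occF? b B
  occF? b (eq τ s t) = occT? b s ⊎-dec occT? b t
  occF? b (nat t) = occT? b t
  occF? b (atm p ts) = occTs? b ts

  maxT : ∀ {Γ τ} → Tm Γ τ → ℕ
  maxT (var v) = 0
  maxT (nomc ι k) = k
  maxT (con c) = 0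
  maxT zc = 0
  maxT sc = 0
  maxT (lam t) = maxT t
  maxT (app t u) = maxT t ⊔ maxT u

  maxTs : ∀ {Γ Ξ} → Tms Γ Ξ → ℕ
  maxTs [] = 0
  maxTs (t ∷ ts) = maxT t ⊔ maxTs ts

  maxF : ∀ {Γ} → Fm Γ → ℕ
  maxF top = 0
  maxF bot = 0
  maxF (B and C) = maxF B ⊔ maxF C
  maxF (B or C) = maxF B ⊔ maxF C
  maxF (B imp C) = maxF B ⊔ maxF C
  maxF (all τ B) = maxF B
  maxF (ex τ B) = maxF B
  maxF (nab ι B) = maxF B
  maxF (eq τ s t) = maxT s ⊔ maxT t
  maxF (nat t) = maxT t
  maxF (atm p ts) = maxTs ts

  maxT-ok : ∀ {Γ τ} (t : Tm Γ τ) ι k → occT (ι , k) t → k ≤ maxT t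
  maxT-ok (nomc ι k) .ι .k refl = NP.≤-refl
  maxT-ok (lam t) ι k o = maxT-ok t ι k o
  maxT-ok (app t u) ι k (inj₁ o) = NP.≤-trans (maxT-ok t ι k o) (NP.m≤m⊔n _ _)
  maxT-ok (app t u) ι k (inj₂ o) = NP.≤-trans (maxT-ok u ι k o) (NP.m≤n⊔m _ _)

  maxTs-ok : ∀ {Γ Ξ} (ts : Tms Γ Ξ) ι k → occTs (ι , k) ts → k ≤ maxTs ts
  maxTs-ok (t ∷ ts) ι k (inj₁ o) = NP.≤-trans (maxT-ok t ι k o) (NP.m≤m⊔n _ _)
  maxTs-ok (t ∷ ts) ι k (inj₂ o) = NP.≤-trans (maxTs-ok ts ι k o) (NP.m≤n⊔m _ _)

  maxF-ok : ∀ {Γ} (B : Fm Γ) ι k → occF (ι , k) B → k ≤ maxF B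
  maxF-ok (B and C) ι k (inj₁ o) = NP.≤-trans (maxF-ok B ι k o) (NP.m≤m⊔n _ _)
  maxF-ok (B and C) ι k (inj₂ o) = NP.≤-trans (maxF-ok C ι k o) (NP.m≤n⊔m _ _)
  maxF-ok (B or C) ι k (inj₁ o) = NP.≤-trans (maxF-ok B ι k o) (NP.m≤m⊔n _ _)
  maxF-ok (B or C) ι k (inj₂ o) = NP.≤-trans (maxF-ok C ι k o) (NP.m≤n⊔m _ _)
  maxF-ok (B imp C) ι k (inj₁ o) = NP.≤-trans (maxF-ok B ι k o) (NP.m≤m⊔n _ _)
  maxF-ok (B imp C) ι k (inj₂ o) = NP.≤-trans (maxF-ok C ι k o) (NP.m≤n⊔m _ _)
  maxF-ok (all τ B) ι k o = maxF-ok B ι k o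
  maxF-ok (ex τ B) ι k o = maxF-ok B ι k o
  maxF-ok (nab ι' B) ι k o = maxF-ok B ι k o
  maxF-ok (eq τ s t) ι k (inj₁ o) = NP.≤-trans (maxT-ok s ι k o) (NP.m≤m⊔n _ _)
  maxF-ok (eq τ s t) ι k (inj₂ o) = NP.≤-trans (maxT-ok t ι k o) (NP.m≤n⊔m _ _)
  maxF-ok (nat t) ι k o = maxT-ok t ι k o
  maxF-ok (atm p ts) ι k o = maxTs-ok ts ι k o

  fresh : ℕ → ℕ → ℕ
  fresh x y = suc (x ⊔ y)

  fresh-≢ˡ : ∀ {k} x y → k ≤ x → k ≢ fresh x y
  fresh-≢ˡ x y k≤x = NP.<⇒≢ (s≤s (NP.≤-trans k≤x (NP.m≤m⊔n x y)))

  fresh-≢ʳ : ∀ {k} x y → k ≤ y → k ≢ fresh x y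
  fresh-≢ʳ x y k≤y = NP.<⇒≢ (s≤s (NP.≤-trans k≤y (NP.m≤n⊔m x y)))

  freshˡ-F : ∀ {Γ} ι (B : Fm Γ) y → ¬ occF (ι , fresh (maxF B) y) B
  freshˡ-F ι B y o = fresh-≢ˡ (maxF B) y (maxF-ok B ι _ o) refl

  freshˡ-T : ∀ {Γ τ} ι (t : Tm Γ τ) y → ¬ occT (ι , fresh (maxT t) y) t
  freshˡ-T ι t y o = fresh-≢ˡ (maxT t) y (maxT-ok t ι _ o) refl

  freshʳ-T : ∀ {Γ τ} ι x (t : Tm Γ τ) → ¬ occT (ι , fresh x (maxT t)) t
  freshʳ-T ι x t o = fresh-≢ʳ x (maxT t) (maxT-ok t ι _ o) refl

  -- Permutations of nominal constants

  idP : Perm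
  idP = record { f = λ _ k → k ; g = λ _ k → k ; fg = λ _ _ → refl ; gf = λ _ _ → refl ; dom = [] ; fin = λ _ _ _ → refl }

  _∘P_ : Perm → Perm → Perm
  π₁ ∘P π₂ = record
    { f = λ ι k → Perm.f π₁ ι (Perm.f π₂ ι k)
    ; g = λ ι k → Perm.g π₂ ι (Perm.g π₁ ι k)
    ; fg = λ ι k → trans (cong (Perm.f π₁ ι) (Perm.fg π₂ ι _)) (Perm.fg π₁ ι k)
    ; gf = λ ι k → trans (cong (Perm.g π₂ ι) (Perm.gf π₁ ι _)) (Perm.gf π₂ ι k)
    ; dom = Perm.dom π₁ ++ Perm.dom π₂
    ; fin = λ ι k n → trans (cong (Perm.f π₁ ι) (Perm.fin π₂ ι k (λ m → n (∈-++⁺ʳ (Perm.dom π₁) m))))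
                            (Perm.fin π₁ ι k (λ m → n (∈-++⁺ˡ m)))
    }

  invP : Perm → Perm
  invP π = record
    { f = Perm.g π ; g = Perm.f π ; fg = Perm.gf π ; gf = Perm.fg π ; dom = Perm.dom π
    ; fin = λ ι k n → trans (cong (Perm.g π ι) (sym (Perm.fin π ι k n))) (Perm.gf π ι k) }

  swℕ : ℕ → ℕ → ℕ → ℕ
  swℕ m n k with k ≟ m
  ... | yes _ = n
  ... | no _ with k ≟ n
  ... | yes _ = m
  ... | no _ = k

  swℕ-inv : ∀ m n k → swℕ m n (swℕ m n k) ≡ k
  swℕ-inv m n k with k ≟ m
  swℕ-inv m n k | yes refl with n ≟ m
  ... | yes refl = refl
  ... | no _ with n ≟ n
  ... | yes _ = refl
  ... | no ¬p = ⊥-elim (¬p refl)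
  swℕ-inv m n k | no k≢m with k ≟ n
  swℕ-inv m n k | no k≢m | yes refl with m ≟ m
  ... | yes _ = refl
  ... | no ¬p = ⊥-elim (¬p refl)
  swℕ-inv m n k | no k≢m | no k≢n with k ≟ m
  ... | yes p = ⊥-elim (k≢m p)
  ... | no _ with k ≟ n
  ... | yes p = ⊥-elim (k≢n p)
  ... | no _ = refl

  swℕ-m : ∀ m n → swℕ m n m ≡ n
  swℕ-m m n with m ≟ m
  ... | yes _ = refl
  ... | no ¬p = ⊥-elim (¬p refl)

  swℕ-n : ∀ m n → swℕ m n n ≡ m
  swℕ-n m n with n ≟ m
  ... | yes refl = refl
  ... | no _ with n ≟ n
  ... | yes _ = refl
  ... | no ¬p = ⊥-elim (¬p refl)

  swℕ-other : ∀ m n k → ¬ k ≡ m → ¬ k ≡ n → swℕ m n k ≡ k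
  swℕ-other m n k p q with k ≟ m
  ... | yes r = ⊥-elim (p r)
  ... | no _ with k ≟ n
  ... | yes r = ⊥-elim (q r)
  ... | no _ = refl

  swf : ℕ → ℕ → ℕ → ℕ → ℕ → ℕ
  swf ι₀ m n ι k with ι ≟ ι₀
  ... | yes _ = swℕ m n k
  ... | no _ = k

  swf-inv : ∀ ι₀ m n ι k → swf ι₀ m n ι (swf ι₀ m n ι k) ≡ k
  swf-inv ι₀ m n ι k with ι ≟ ι₀
  ... | yes _ = swℕ-inv m n k
  ... | no _ = refl

  swf-same : ∀ ι₀ m n k → swf ι₀ m n ι₀ k ≡ swℕ m n k
  swf-same ι₀ m n k with ι₀ ≟ ι₀
  ... | yes _ = refl
  ... | no ¬p = ⊥-elim (¬p refl)

  swf-fix : ∀ ι₀ m n ι k → ¬ (ι , k) ≡ (ι₀ , m) → ¬ (ι , k) ≡ (ι₀ , n) → swf ι₀ m n ι k ≡ k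
  swf-fix ι₀ m n ι k p q with ι ≟ ι₀
  ... | no _ = refl
  ... | yes refl = swℕ-other m n k (λ e → p (cong (ι ,_) e)) (λ e → q (cong (ι ,_) e))

  swapP : ℕ → ℕ → ℕ → Perm
  swapP ι₀ m n = record
    { f = swf ι₀ m n ; g = swf ι₀ m n ; fg = swf-inv ι₀ m n ; gf = swf-inv ι₀ m n
    ; dom = (ι₀ , m) ∷ (ι₀ , n) ∷ []
    ; fin = λ ι k nn → swf-fix ι₀ m n ι k (λ e → nn (here e)) (λ e → nn (there (here e))) }

  -- βη-conversion

  inst-wk : ∀ {Γ τ σ₀} (U : Tm Γ σ₀) (w : Tm Γ τ) → subVN (inst U) nomc (ren there w) ≡ w
  inst-wk U w = trans (subVN-ren (inst U) nomc there w) (trans (subVN-cong (λ v → refl) (λ ι k → refl) w) (subVN-id w))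

  subVN-inst : ∀ {Γ Δ τ σ₀} (σ : Sub Γ Δ) (η : NameSub Δ) (u : Tm Γ σ₀) (t : Tm (σ₀ ∷ Γ) τ) →
    subVN σ η (sub (inst u) t) ≡ sub (inst (subVN σ η u)) (subVN (extS σ) (extN η) t)
  subVN-inst σ η u t = begin
      subVN σ η (sub (inst u) t)
    ≡⟨ cong (subVN σ η) (sub-as-subVN (inst u) t) ⟩
      subVN σ η (subVN (inst u) nomc t)
    ≡⟨ subVN-subVN σ η (inst u) nomc t ⟩
      subVN (λ v → subVN σ η (inst u v)) (λ ι k → η ι k) t
    ≡⟨ subVN-cong (λ { here → refl ; (there v) → sym (inst-wk (subVN σ η u) (σ v)) }) (λ ι k → sym (inst-wk (subVN σ η u) (η ι k))) t ⟩
      subVN (λ v → subVN (inst (subVN σ η u)) nomc (extS σ v)) (λ ι k → subVN (inst (subVN σ η u)) nomc (extN η ι k)) t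
    ≡⟨ sym (subVN-subVN (inst (subVN σ η u)) nomc (extS σ) (extN η) t) ⟩
      subVN (inst (subVN σ η u)) nomc (subVN (extS σ) (extN η) t)
    ≡⟨ sym (sub-as-subVN (inst (subVN σ η u)) (subVN (extS σ) (extN η) t)) ⟩
      sub (inst (subVN σ η u)) (subVN (extS σ) (extN η) t)
    ∎ where open ≡-Reasoning

  ≈-≡ : ∀ {Γ τ} {t u u' : Tm Γ τ} → t ≈ u → u ≡ u' → t ≈ u'
  ≈-≡ p refl = p

  ≡-≈ : ∀ {Γ τ} {t t' u : Tm Γ τ} → t ≡ t' → t' ≈ u → t ≈ u
  ≡-≈ refl p = p

  ≈-subVN : ∀ {Γ Δ τ} (σ : Sub Γ Δ) (η : NameSub Δ) {t u : Tm Γ τ} → t ≈ u → subVN σ η t ≈ subVN σ η u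
  ≈-subVN σ η ≈refl = ≈refl
  ≈-subVN σ η (≈sym p) = ≈sym (≈-subVN σ η p)
  ≈-subVN σ η (≈trans p q) = ≈trans (≈-subVN σ η p) (≈-subVN σ η q)
  ≈-subVN σ η (≈lam p) = ≈lam (≈-subVN (extS σ) (extN η) p)
  ≈-subVN σ η (≈app p q) = ≈app (≈-subVN σ η p) (≈-subVN σ η q)
  ≈-subVN σ η (≈β t u) = ≈-≡ (≈β _ _) (sym (subVN-inst σ η u t))
  ≈-subVN σ η (≈η t) = ≈-≡ (≈η (subVN σ η t)) (cong (λ z → lam (app z (var here))) (sym (subVN-wk σ η t)))

  ≈s-subVN : ∀ {Γ Δ Ξ} (σ : Sub Γ Δ) (η : NameSub Δ) {ts us : Tms Γ Ξ} → ts ≈s us → subVNs σ η ts ≈s subVNs σ η us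
  ≈s-subVN σ η [] = []
  ≈s-subVN σ η (p ∷ ps) = ≈-subVN σ η p ∷ ≈s-subVN σ η ps

  ≈F-subVN : ∀ {Γ Δ} (σ : Sub Γ Δ) (η : NameSub Δ) {B C : Fm Γ} → B ≈F C → subVNF σ η B ≈F subVNF σ η C
  ≈F-subVN σ η top = top
  ≈F-subVN σ η bot = bot
  ≈F-subVN σ η (cand p q) = cand (≈F-subVN σ η p) (≈F-subVN σ η q)
  ≈F-subVN σ η (cor p q) = cor (≈F-subVN σ η p) (≈F-subVN σ η q)
  ≈F-subVN σ η (cimp p q) = cimp (≈F-subVN σ η p) (≈F-subVN σ η q)
  ≈F-subVN σ η (all p) = all (≈F-subVN (extS σ) (extN η) p)
  ≈F-subVN σ η (ex p) = ex (≈F-subVN (extS σ) (extN η) p)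
  ≈F-subVN σ η (nab p) = nab (≈F-subVN (extS σ) (extN η) p)
  ≈F-subVN σ η (eq p q) = eq (≈-subVN σ η p) (≈-subVN σ η q)
  ≈F-subVN σ η (nat p) = nat (≈-subVN σ η p)
  ≈F-subVN σ η (atm p) = atm (≈s-subVN σ η p)

  ≈F-≡ : ∀ {Γ} {B C C' : Fm Γ} → B ≈F C → C ≡ C' → B ≈F C'
  ≈F-≡ p refl = p
  ≡-≈F : ∀ {Γ} {B B' C : Fm Γ} → B ≡ B' → B' ≈F C → B ≈F C
  ≡-≈F refl p = p

  wkSub : ∀ {Γ σ₀} → Sub Γ (σ₀ ∷ Γ)
  wkSub w = var (there w)

  η-open : ∀ {Γ τ σ₀} (u : Tm (σ₀ ∷ Γ) τ) → app (subVN wkSub nomc (lam u)) (var here) ≈ u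
  η-open u = ≈-≡ (≈β _ _) (trans (sub-as-subVN (inst (var here)) (subVN (extS wkSub) (extN nomc) u)) (trans (subVN-subVN (inst (var here)) nomc (extS wkSub) (extN nomc) u)
     (trans (subVN-cong (λ { here → refl ; (there v) → refl }) (λ ι k → refl) u) (subVN-id u))))

  lam-inj : ∀ {Γ τ σ₀} {u v : Tm (σ₀ ∷ Γ) τ} → lam u ≈ lam v → u ≈ v
  lam-inj {u = u} {v} p = ≈trans (≈sym (η-open u)) (≈trans (≈app (≈-subVN wkSub nomc p) ≈refl) (η-open v))

  NomFreeTm : ∀ {Γ τ} → Tm Γ τ → Set
  NomFreeTm t = ∀ b → ¬ occT b t

  subVN-nomFree-cong : ∀ {Γ Δ τ} {σ σ₂ : Sub Γ Δ} {η η' : NameSub Δ} (t : Tm Γ τ) → NomFreeTm t → σ ≗S σ₂ → subVN σ η t ≡ subVN σ₂ η' t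
  subVN-nomFree-cong t n es = subVN-cong-occ t (λ v _ → es v) (λ ι k o → ⊥-elim (n _ o))

  nomFree-subVN : ∀ {Γ Δ τ} (σ : Sub Γ Δ) (η : NameSub Δ) (t : Tm Γ τ) → NomFreeSub σ → NomFreeTm t → NomFreeTm (subVN σ η t)
  nomFree-subVN σ η t nσ nt b o with occ-subVN⁻ b σ η t o
  ... | inj₁ (_ , v , o') = nσ v b o'
  ... | inj₂ (_ , _ , oc , _) = nt _ oc

  nomFree-ren : ∀ {Γ Δ τ} (ρ : Ren Γ Δ) (t : Tm Γ τ) → NomFreeTm t → NomFreeTm (ren ρ t)
  nomFree-ren ρ t n b o = n b (occ-ren⁻ b ρ t o)

  nomFreeSub-extS : ∀ {Γ Δ σ₀} (σ : Sub Γ Δ) → NomFreeSub σ → NomFreeSub (extS {σ = σ₀} σ)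
  nomFreeSub-extS σ n here b ()
  nomFreeSub-extS σ n (there v) b o = n v b (occ-ren⁻ b there (σ v) o)

  nomFreeSub-var : ∀ {Γ} → NomFreeSub (var {Γ})
  nomFreeSub-var v b ()

  πN : Perm → NomC → NomC
  πN π (ι' , k) = (ι' , Perm.f π ι' k)

  f-injective : ∀ (π : Perm) ι' {k₁ k₂} → Perm.f π ι' k₁ ≡ Perm.f π ι' k₂ → k₁ ≡ k₂
  f-injective π ι' {k₁} {k₂} e = trans (sym (Perm.gf π ι' k₁)) (trans (cong (Perm.g π ι') e) (Perm.gf π ι' k₂))

  occ-perm⁺ : ∀ {Γ} (π : Perm) (B : Fm Γ) (ι' k : ℕ) → occF (ι' , k) B → occF (ι' , Perm.f π ι' k) (permF π B)
  occ-perm⁺ π B ι' k o = subst (occF _) (sym (permF-as-subVN π B)) (occF-subVN⁺ _ var (permNames π) B ι' k o refl)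

  ≈F-subF : ∀ {Γ Δ} (σ : Sub Γ Δ) {B C : Fm Γ} → B ≈F C → subF σ B ≈F subF σ C
  ≈F-subF σ {B} {C} p = ≡-≈F (subF-as-subVN σ B) (≈F-≡ (≈F-subVN σ nomc p) (sym (subF-as-subVN σ C)))

  subF-permF : ∀ {Γ Δ} (σ : Sub Γ Δ) (π : Perm) (B : Fm Γ) → subF σ (permF π B) ≡ subVNF σ (permNames π) B
  subF-permF σ π B = trans (subF-as-subVN σ _) (trans (cong (subVNF σ nomc) (permF-as-subVN π B)) (subVNF-subVNF σ nomc var (permNames π) B))

  fresh-subF : ∀ {Γ Γ'} (σ : Sub Γ' Γ) (b : NomC) (D : Fm Γ') → ¬ occF b D → (∀ {τ} (v : Var Γ' τ) → ¬ occT b (σ v)) → ¬ occF b (subF σ D)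
  fresh-subF σ b D nD nσ o with occF-subVN⁻ b σ nomc D (subst (occF b) (subF-as-subVN σ D) o)
  ... | inj₁ (_ , v , o') = nσ v o'
  ... | inj₂ (ι' , k , oc , o') = nD (subst (λ z → occF z D) o' oc)

  raise-map-πN : ∀ (π : Perm) (cs : List NomC) τ → raise (map (πN π) cs) τ ≡ raise cs τ
  raise-map-πN π [] τ = refl
  raise-map-πN π (c ∷ cs) τ = cong (nom (proj₁ c) ⇒_) (raise-map-πN π cs τ)

  subst-app : ∀ {Γ A Bt Ct} (e : Ct ≡ Bt) (W : Tm Γ (A ⇒ Bt)) (n : Tm Γ A) →
    subst (Tm Γ) (sym e) (app W n) ≡ app (subst (Tm Γ) (sym (cong (A ⇒_) e)) W) n
  subst-app refl W n = refl

  subst-lam : ∀ {Γ A Bt Ct} (e : Bt ≡ Ct) (Y : Tm (A ∷ Γ) Bt) →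
    lam (subst (Tm (A ∷ Γ)) e Y) ≡ subst (Tm Γ) (cong (A ⇒_) e) (lam Y)
  subst-lam refl Y = refl

  sub-subst : ∀ {Γ Δ A Bt} (σ : Sub Γ Δ) (e : A ≡ Bt) (t : Tm Γ A) →
    sub σ (subst (Tm Γ) e t) ≡ subst (Tm Δ) e (sub σ t)
  sub-subst σ refl t = refl

  occ-subst : ∀ {Γ A Bt} b (e : A ≡ Bt) (t : Tm Γ A) → occT b (subst (Tm Γ) e t) → occT b t
  occ-subst b refl t o = o

  ≈-subst⁻ : ∀ {Γ A Bt} (e : A ≡ Bt) {p q : Tm Γ A} → subst (Tm Γ) e p ≈ subst (Tm Γ) e q → p ≈ q
  ≈-subst⁻ refl h = h

  appNoms-perm : ∀ {Γ Δ τ} (σ : Sub Γ Δ) (π : Perm) (cs : List NomC) (w : Tm Γ (raise cs τ)) →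
    subVN σ (permNames π) (appNoms cs w) ≡ appNoms (map (πN π) cs) (subst (Tm Δ) (sym (raise-map-πN π cs τ)) (subVN σ (permNames π) w))
  appNoms-perm σ π [] w = refl
  appNoms-perm {τ = τ} σ π (c ∷ cs) w =
    trans (appNoms-perm σ π cs (app w (nomc (proj₁ c) (proj₂ c))))
          (cong (appNoms (map (πN π) cs)) (subst-app (raise-map-πN π cs τ) (subVN σ (permNames π) w) _))

  occ-appNoms : ∀ {Γ τ} b (cs : List NomC) (w : Tm Γ (raise cs τ)) → occT b (appNoms cs w) → occT b w ⊎ b ∈ cs
  occ-appNoms b [] w o = inj₁ o
  occ-appNoms b (c ∷ cs) w o with occ-appNoms b cs _ o
  ... | inj₁ (inj₁ o') = inj₁ o'
  ... | inj₁ (inj₂ e) = inj₂ (here (sym e))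
  ... | inj₂ m = inj₂ (there m)

  πN-injective : ∀ (π : Perm) {c₁ c₂ : NomC} → πN π c₁ ≡ πN π c₂ → c₁ ≡ c₂
  πN-injective π {ι₁ , k₁} {ι₂ , k₂} e with cong proj₁ e
  ... | refl = cong (ι₁ ,_) (f-injective π ι₁ (cong proj₂ e))

  consIf : ∀ {P : Set} → Dec P → NomC → List NomC → List NomC
  consIf (yes _) c cs = c ∷ cs
  consIf (no _)  c cs = cs

  nameToVar-hit : ∀ {Δ} ι' k (x : Var Δ (nom ι')) → nameToVar ι' k x ι' k ≡ var x
  nameToVar-hit ι' k x with ι' ≟ ι' | k ≟ k
  ... | yes refl | yes refl = refl
  ... | no ¬p | _ = ⊥-elim (¬p refl)
  ... | yes refl | no ¬p = ⊥-elim (¬p refl)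

  nameToVar-miss : ∀ {Δ} ι' k (x : Var Δ (nom ι')) ι'' k'' → ¬ (ι' , k) ≡ (ι'' , k'') → nameToVar ι' k x ι'' k'' ≡ nomc ι'' k''
  nameToVar-miss ι' k x ι'' k'' ne with ι' ≟ ι'' | k ≟ k''
  ... | yes refl | yes refl = ⊥-elim (ne refl)
  ... | yes refl | no _ = refl
  ... | no _ | _ = refl

  nameToVar-perm : ∀ {Δ} (π : Perm) ι' k (x : Var Δ (nom ι')) ι'' k'' →
    subVN var (permNames π) (nameToVar ι' k x ι'' k'') ≡ nameToVar ι' (Perm.f π ι' k) x ι'' (Perm.f π ι'' k'')
  nameToVar-perm π ι' k x ι'' k'' with (ι' , k) ≟N (ι'' , k'')
  ... | yes refl = trans (cong (subVN var (permNames π)) (nameToVar-hit ι' k x)) (sym (nameToVar-hit ι' _ x))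
  ... | no ne = trans (cong (subVN var (permNames π)) (nameToVar-miss ι' k x ι'' k'' ne))
                      (sym (nameToVar-miss ι' _ x ι'' _ (λ e → ne (πN-injective π e))))

  nameToVar-extS : ∀ {Γ Δ} (σ : Sub Γ Δ) ι' k ι'' k'' →
    subVN (extS {σ = nom ι'} σ) nomc (nameToVar ι' k here ι'' k'') ≡ nameToVar ι' k here ι'' k''
  nameToVar-extS σ ι' k ι'' k'' with (ι' , k) ≟N (ι'' , k'')
  ... | yes refl = trans (cong (subVN (extS σ) nomc) (nameToVar-hit ι' k here)) (sym (nameToVar-hit ι' k here))
  ... | no ne = trans (cong (subVN (extS σ) nomc) (nameToVar-miss ι' k here ι'' k'' ne)) (sym (nameToVar-miss ι' k here ι'' k'' ne))

  permT-inverse : ∀ {Γ τ} (π : Perm) (x : Tm Γ τ) → permT (invP π) (permT π x) ≡ x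
  permT-inverse π x = trans (permT-as-subVN (invP π) _) (trans (cong (subVN var (permNames (invP π))) (permT-as-subVN π x))
    (trans (subVN-subVN var (permNames (invP π)) var (permNames π) x)
    (trans (subVN-cong (λ v → refl) (λ ι' k → cong (nomc ι') (Perm.gf π ι' k)) x) (subVN-id x))))

  ≈-permT⁻ : ∀ {Γ τ} (π : Perm) {x y : Tm Γ τ} → permT π x ≈ permT π y → x ≈ y
  ≈-permT⁻ π {x} {y} p = ≡-≈ (sym (permT-inverse π x)) (≈-≡ (≡-≈ (permT-as-subVN (invP π) _) (≈-≡ (≈-subVN var (permNames (invP π)) p) (sym (permT-as-subVN (invP π) _)))) (permT-inverse π y))

  sub-sub : ∀ {Γ Δ Ξ τ} (σ : Sub Δ Ξ) (θ : Sub Γ Δ) (x : Tm Γ τ) → sub σ (sub θ x) ≡ sub (λ v → sub σ (θ v)) x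
  sub-sub σ θ x = trans (sub-as-subVN σ (sub θ x)) (trans (cong (subVN σ nomc) (sub-as-subVN θ x)) (trans (subVN-subVN σ nomc θ nomc x)
    (trans (subVN-cong (λ v → sym (sub-as-subVN σ (θ v))) (λ _ _ → refl) x) (sym (sub-as-subVN _ x)))))

  fresh-sub-nomFree : ∀ {Γ Δ τ} (θ : Sub Γ Δ) → NomFreeSub θ → (b : NomC) (x : Tm Γ τ) → ¬ occT b x → ¬ occT b (sub θ x)
  fresh-sub-nomFree θ nθ b x nx o with occ-subVN⁻ b θ nomc x (subst (occT b) (sub-as-subVN θ x) o)
  ... | inj₁ (_ , v , o') = nθ v b o'
  ... | inj₂ (_ , _ , oc , refl) = nx oc

  fresh-wkF : ∀ {Σ' σ₀} (b : NomC) (B : Fm Σ') → ¬ occF b B → ¬ occF b (wkF {σ = σ₀} B)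
  fresh-wkF b B nB o = fresh-subF (λ v → var (there v)) b B nB (λ v ()) (subst (occF b) (trans (renF-as-subVN there B) (sym (subF-as-subVN _ B))) o)

  fresh-subF-nomFree : ∀ {Γ Δ} (θ : Sub Γ Δ) → NomFreeSub θ → (b : NomC) (B : Fm Γ) → ¬ occF b B → ¬ occF b (subF θ B)
  fresh-subF-nomFree θ nθ b B nB = fresh-subF θ b B nB (λ v → nθ v b)

  tmsSub-subVN : ∀ {Γ Δ Ξ τ} (σ : Sub Γ Δ) (η : NameSub Δ) (ts : Tms Γ Ξ) (v : Var Ξ τ) → tmsSub (subVNs σ η ts) v ≡ subVN σ η (tmsSub ts v)
  tmsSub-subVN σ η (t ∷ ts) here = refl
  tmsSub-subVN σ η (t ∷ ts) (there v) = tmsSub-subVN σ η ts v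

  occ-tmsSub : ∀ {Γ Ξ τ} b (ts : Tms Γ Ξ) (v : Var Ξ τ) → occT b (tmsSub ts v) → occTs b ts
  occ-tmsSub b (t ∷ ts) here o = inj₁ o
  occ-tmsSub b (t ∷ ts) (there v) o = inj₂ (occ-tmsSub b ts v o)

  fresh-unfold : ∀ {Γ Ξ} (b : NomC) (ts : Tms Γ Ξ) (Bd : Fm Ξ) → (∀ b → ¬ occF b Bd) → ¬ occTs b ts → ¬ occF b (subF (tmsSub ts) Bd)
  fresh-unfold b ts Bd nb nts = fresh-subF (tmsSub ts) b Bd (nb b) (λ v o → nts (occ-tmsSub b ts v o))

  absAt-perm : ∀ {Γ τ} (π : Perm) ι' k (u : Tm Γ τ) →
    permT π (absAt ι' k there here u) ≡ absAt ι' (Perm.f π ι' k) there here (permT π u)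
  absAt-perm π ι' k u = begin
      permT π (absAt ι' k there here u)
    ≡⟨ trans (permT-as-subVN π _) (cong (subVN var (permNames π)) (absAt-as-subVN ι' k there here u)) ⟩
      subVN var (permNames π) (subVN (λ v → var (there v)) (nameToVar ι' k here) u)
    ≡⟨ subVN-subVN var (permNames π) _ _ u ⟩
      subVN (λ v → var (there v)) (λ ι'' k'' → subVN var (permNames π) (nameToVar ι' k here ι'' k'')) u
    ≡⟨ subVN-cong (λ v → refl) (λ ι'' k'' → nameToVar-perm π ι' k here ι'' k'') u ⟩
      subVN (λ v → subVN (λ w → var (there w)) (nameToVar ι' (Perm.f π ι' k) here) (var v)) (λ ι'' k'' → subVN (λ w → var (there w)) (nameToVar ι' (Perm.f π ι' k) here) (permNames π ι'' k'')) u
    ≡⟨ sym (subVN-subVN (λ w → var (there w)) (nameToVar ι' (Perm.f π ι' k) here) var (permNames π) u) ⟩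
      subVN (λ v → var (there v)) (nameToVar ι' (Perm.f π ι' k) here) (subVN var (permNames π) u)
    ≡⟨ sym (trans (absAt-as-subVN ι' (Perm.f π ι' k) there here (permT π u)) (cong (subVN (λ v → var (there v)) (nameToVar ι' (Perm.f π ι' k) here)) (permT-as-subVN π u))) ⟩
      absAt ι' (Perm.f π ι' k) there here (permT π u)
    ∎ where open ≡-Reasoning

  absN-perm : ∀ {Γ τ} (π : Perm) (cs : List NomC) (u : Tm Γ τ) →
    permT π (absN cs u) ≡ subst (Tm Γ) (raise-map-πN π cs τ) (absN (map (πN π) cs) (permT π u))
  absN-perm π [] u = refl
  absN-perm {τ = τ} π (c ∷ cs) u =
    trans (cong lam (absN-perm π cs (absAt (proj₁ c) (proj₂ c) there here u)))
    (trans (cong (λ z → lam (subst (Tm _) (raise-map-πN π cs τ) (absN (map (πN π) cs) z))) (absAt-perm π (proj₁ c) (proj₂ c) u))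
           (subst-lam (raise-map-πN π cs τ) _))

  absAt-sub : ∀ {Γ Δ τ} (σ : Sub Γ Δ) → NomFreeSub σ → ∀ ι' k (u : Tm Γ τ) →
    sub (extS σ) (absAt ι' k there here u) ≡ absAt ι' k there here (sub σ u)
  absAt-sub σ nσ ι' k u = begin
      sub (extS σ) (absAt ι' k there here u)
    ≡⟨ trans (sub-as-subVN (extS σ) (absAt ι' k there here u)) (cong (subVN (extS σ) nomc) (absAt-as-subVN ι' k there here u)) ⟩
      subVN (extS σ) nomc (subVN (λ v → var (there v)) (nameToVar ι' k here) u)
    ≡⟨ subVN-subVN (extS σ) nomc _ _ u ⟩
      subVN (λ v → ren there (σ v)) (λ ι'' k'' → subVN (extS σ) nomc (nameToVar ι' k here ι'' k'')) u
    ≡⟨ subVN-cong (λ v → trans (ren-as-subVN there (σ v)) (subVN-nomFree-cong (σ v) (nσ v) (λ w → refl))) (λ ι'' k'' → nameToVar-extS σ ι' k ι'' k'') u ⟩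
      subVN (λ v → subVN (λ w → var (there w)) (nameToVar ι' k here) (σ v)) (λ ι'' k'' → subVN (λ w → var (there w)) (nameToVar ι' k here) (nomc ι'' k'')) u
    ≡⟨ sym (subVN-subVN (λ w → var (there w)) (nameToVar ι' k here) σ nomc u) ⟩
      subVN (λ w → var (there w)) (nameToVar ι' k here) (subVN σ nomc u)
    ≡⟨ sym (trans (absAt-as-subVN ι' k there here (sub σ u)) (cong (subVN (λ v → var (there v)) (nameToVar ι' k here)) (sub-as-subVN σ u))) ⟩
      absAt ι' k there here (sub σ u)
    ∎ where open ≡-Reasoning

  absN-sub : ∀ {Γ Δ τ} (σ : Sub Γ Δ) → NomFreeSub σ → (cs : List NomC) (u : Tm Γ τ) →
    sub σ (absN cs u) ≡ absN cs (sub σ u)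
  absN-sub σ nσ [] u = refl
  absN-sub σ nσ (c ∷ cs) u = cong lam (trans (absN-sub (extS σ) (nomFreeSub-extS σ nσ) cs _) (cong (absN cs) (absAt-sub σ nσ (proj₁ c) (proj₂ c) u)))

  sub-permT-nomFree : ∀ {Γ Δ τ} (σ : Sub Γ Δ) → NomFreeSub σ → (π : Perm) (x : Tm Γ τ) → sub σ (permT π x) ≡ permT π (sub σ x)
  sub-permT-nomFree σ nσ π x = begin
      sub σ (permT π x)
    ≡⟨ trans (sub-as-subVN σ (permT π x)) (cong (subVN σ nomc) (permT-as-subVN π x)) ⟩
      subVN σ nomc (subVN var (permNames π) x)
    ≡⟨ subVN-subVN σ nomc var (permNames π) x ⟩
      subVN (λ v → σ v) (permNames π) x
    ≡⟨ subVN-cong (λ v → sym (trans (subVN-nomFree-cong (σ v) (nσ v) (λ w → refl)) (subVN-id (σ v)))) (λ _ _ → refl) x ⟩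
      subVN (λ v → subVN var (permNames π) (σ v)) (λ ι' k → subVN var (permNames π) (nomc ι' k)) x
    ≡⟨ sym (subVN-subVN var (permNames π) σ nomc x) ⟩
      subVN var (permNames π) (subVN σ nomc x)
    ≡⟨ sym (trans (permT-as-subVN π _) (cong (subVN var (permNames π)) (sub-as-subVN σ x))) ⟩
      permT π (sub σ x)
    ∎ where open ≡-Reasoning

module NameSubstitution (𝒮 : Sig) (ι : ℕ) where

  open LG 𝒮
  open Syntax 𝒮

  Ann : Set
  Ann = Perm × ℕ

  closeAt : ∀ {Γ Δ} → Sub Γ (nom ι ∷ Δ) → ℕ → Sub Γ Δ
  closeAt θ n v = sub (inst (nomc ι n)) (θ v)

  trF : ∀ {Γ Δ} → Sub Γ (nom ι ∷ Δ) → Ann → Fm Γ → Fm Δ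
  trF θ (π , a) B = permF π (subF (inst (nomc ι a)) (subF θ B))

  trT : ∀ {Γ Δ τ} → Sub Γ (nom ι ∷ Δ) → Ann → Tm Γ τ → Tm Δ τ
  trT θ (π , a) t = permT π (sub (inst (nomc ι a)) (sub θ t))

  trF-id : ∀ {Γ} (a : ℕ) (B : Fm (nom ι ∷ Γ)) → trF var (idP , a) B ≡ subF (inst (nomc ι a)) B
  trF-id a B = trans (trans (permF-as-subVN idP _) (subVNF-id _)) (cong (subF (inst (nomc ι a))) (subF-id B))

  fι : Perm → ℕ → ℕ
  fι π a = Perm.f π ι a

  perm-inst-nomFree : ∀ {Δ τ} (π : Perm) (m : ℕ) (u : Tm (nom ι ∷ Δ) τ) → NomFreeTm u →
    subVN (λ w → subVN var (permNames π) (inst (nomc ι m) w)) (permNames π) u ≡ sub (inst (nomc ι (fι π m))) u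
  perm-inst-nomFree π m u n = trans (subVN-nomFree-cong u n (λ { here → refl ; (there w) → refl })) (sym (sub-as-subVN _ u))

  trF-as-subVN : ∀ {Γ Δ} (θ : Sub Γ (nom ι ∷ Δ)) → NomFreeSub θ → (π : Perm) (a : ℕ) (B : Fm Γ) →
    trF θ (π , a) B ≡ subVNF (closeAt θ (fι π a)) (permNames π) B
  trF-as-subVN θ nθ π a B = begin
      permF π (subF (inst (nomc ι a)) (subF θ B))
    ≡⟨ trans (permF-as-subVN π _) (cong (subVNF var (permNames π)) (trans (subF-as-subVN _ _) (cong (subVNF (inst (nomc ι a)) nomc) (subF-as-subVN θ B)))) ⟩
      subVNF var (permNames π) (subVNF (inst (nomc ι a)) nomc (subVNF θ nomc B))
    ≡⟨ cong (subVNF var (permNames π)) (subVNF-subVNF (inst (nomc ι a)) nomc θ nomc B) ⟩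
      subVNF var (permNames π) (subVNF (λ v → subVN (inst (nomc ι a)) nomc (θ v)) (λ ι' k → nomc ι' k) B)
    ≡⟨ subVNF-subVNF var (permNames π) _ _ B ⟩
      subVNF (λ v → subVN var (permNames π) (subVN (inst (nomc ι a)) nomc (θ v))) (λ ι' k → nomc ι' (Perm.f π ι' k)) B
    ≡⟨ subVNF-cong (λ v → trans (subVN-subVN var (permNames π) (inst (nomc ι a)) nomc (θ v))
                         (trans (perm-inst-nomFree π a (θ v) (nθ v)) (refl))) (λ ι' k → refl) B ⟩
      subVNF (λ v → sub (inst (nomc ι (fι π a))) (θ v)) (permNames π) B
    ∎ where open ≡-Reasoning

  trT-as-subVN : ∀ {Γ Δ τ} (θ : Sub Γ (nom ι ∷ Δ)) → NomFreeSub θ → (π : Perm) (a : ℕ) (t : Tm Γ τ) →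
    trT θ (π , a) t ≡ subVN (closeAt θ (fι π a)) (permNames π) t
  trT-as-subVN θ nθ π a t = begin
      permT π (sub (inst (nomc ι a)) (sub θ t))
    ≡⟨ trans (permT-as-subVN π _) (cong (subVN var (permNames π)) (trans (sub-as-subVN (inst (nomc ι a)) (sub θ t)) (cong (subVN (inst (nomc ι a)) nomc) (sub-as-subVN θ t)))) ⟩
      subVN var (permNames π) (subVN (inst (nomc ι a)) nomc (subVN θ nomc t))
    ≡⟨ cong (subVN var (permNames π)) (subVN-subVN (inst (nomc ι a)) nomc θ nomc t) ⟩
      subVN var (permNames π) (subVN (λ v → subVN (inst (nomc ι a)) nomc (θ v)) (λ ι' k → nomc ι' k) t)
    ≡⟨ subVN-subVN var (permNames π) _ _ t ⟩
      subVN (λ v → subVN var (permNames π) (subVN (inst (nomc ι a)) nomc (θ v))) (λ ι' k → nomc ι' (Perm.f π ι' k)) t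
    ≡⟨ subVN-cong (λ v → trans (subVN-subVN var (permNames π) (inst (nomc ι a)) nomc (θ v))
                         (perm-inst-nomFree π a (θ v) (nθ v))) (λ ι' k → refl) t ⟩
      subVN (λ v → sub (inst (nomc ι (fι π a))) (θ v)) (permNames π) t
    ∎ where open ≡-Reasoning

  occ-closeAt : ∀ {Γ Δ τ} (θ : Sub Γ (nom ι ∷ Δ)) → NomFreeSub θ → ∀ n b (v : Var Γ τ) → occT b (closeAt θ n v) → b ≡ (ι , n)
  occ-closeAt θ nθ n b v o with occ-subVN⁻ b (inst (nomc ι n)) nomc (θ v) (subst (occT b) (sub-as-subVN (inst (nomc ι n)) (θ v)) o)
  ... | inj₁ (_ , here , o') = sym o'
  ... | inj₁ (_ , there w , ())
  ... | inj₂ (_ , _ , oc , _) = ⊥-elim (nθ v _ oc)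

  occ-trF⁻ : ∀ {Γ Δ} (θ : Sub Γ (nom ι ∷ Δ)) → NomFreeSub θ → (π : Perm) (a : ℕ) (B : Fm Γ) (b : NomC) →
    occF b (trF θ (π , a) B) → (b ≡ (ι , fι π a)) ⊎ (Σ[ c ∈ NomC ] (occF c B × b ≡ πN π c))
  occ-trF⁻ θ nθ π a B b o with occF-subVN⁻ b (closeAt θ (fι π a)) (permNames π) B (subst (occF b) (trF-as-subVN θ nθ π a B) o)
  ... | inj₁ (_ , v , o') = inj₁ (occ-closeAt θ nθ (fι π a) b v o')
  ... | inj₂ (ι' , k , oc , o') = inj₂ ((ι' , k) , oc , sym o')

  occ-trF⁺ : ∀ {Γ Δ} (θ : Sub Γ (nom ι ∷ Δ)) → NomFreeSub θ → (π : Perm) (a : ℕ) (B : Fm Γ) (ι' k : ℕ) →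
    occF (ι' , k) B → occF (ι' , Perm.f π ι' k) (trF θ (π , a) B)
  occ-trF⁺ θ nθ π a B ι' k o = subst (occF _) (sym (trF-as-subVN θ nθ π a B)) (occF-subVN⁺ _ (closeAt θ (fι π a)) (permNames π) B ι' k o refl)

  perm-closeAt : ∀ {Δ τ} (σ : Perm) (m : ℕ) (u : Tm (nom ι ∷ Δ) τ) → NomFreeTm u →
    subVN var (permNames σ) (sub (inst (nomc ι m)) u) ≡ sub (inst (nomc ι (fι σ m))) u
  perm-closeAt σ m u n = trans (cong (subVN var (permNames σ)) (sub-as-subVN (inst (nomc ι m)) u)) (trans (subVN-subVN var (permNames σ) (inst (nomc ι m)) nomc u) (perm-inst-nomFree σ m u n))

  -- Both sides of an idπ axiom are permuted so that they carry the same fresh name kf in place of x.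
  trF-align : ∀ {Γ Δ} (θ : Sub Γ (nom ι ∷ Δ)) → NomFreeSub θ → (πh πB : Perm) (aB : ℕ) (B : Fm Γ) → ¬ occF (ι , aB) B →
    (kf : ℕ) → ¬ occF (ι , kf) (permF πh B) →
    permF (swapP ι (fι πh aB) kf ∘P (πh ∘P invP πB)) (trF θ (πB , aB) B) ≡ subF (inst (nomc ι kf)) (subF θ (permF πh B))
  trF-align θ nθ πh πB aB B nB kf fr = begin
      permF σ (trF θ (πB , aB) B)
    ≡⟨ trans (permF-as-subVN σ _) (cong (subVNF var (permNames σ)) (trF-as-subVN θ nθ πB aB B)) ⟩
      subVNF var (permNames σ) (subVNF (closeAt θ (fι πB aB)) (permNames πB) B)
    ≡⟨ subVNF-subVNF var (permNames σ) _ _ B ⟩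
      subVNF (λ v → subVN var (permNames σ) (closeAt θ (fι πB aB) v)) (λ ι' k → nomc ι' (Perm.f σ ι' (Perm.f πB ι' k))) B
    ≡⟨ subVNF-cong-occ B (λ v _ → trans (perm-closeAt σ _ (θ v) (nθ v)) (cong (λ z → sub (inst (nomc ι z)) (θ v)) σ-aB))
                        (λ ι' k o → cong (nomc ι') (σ-fixes-B ι' k o)) ⟩
      subVNF (λ v → sub (inst (nomc ι kf)) (θ v)) (permNames πh) B
    ≡⟨ subVNF-cong (λ v → sub-as-subVN _ (θ v)) (λ _ _ → refl) B ⟩
      subVNF (λ v → subVN (inst (nomc ι kf)) nomc (subVN θ nomc (var v))) (λ ι' k → subVN (inst (nomc ι kf)) nomc (subVN θ nomc (permNames πh ι' k))) B
    ≡⟨ sym (subVNF-subVNF (inst (nomc ι kf)) nomc (λ v → subVN θ nomc (var v)) (λ ι' k → subVN θ nomc (permNames πh ι' k)) B) ⟩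
      subVNF (inst (nomc ι kf)) nomc (subVNF (λ v → subVN θ nomc (var v)) (λ ι' k → subVN θ nomc (permNames πh ι' k)) B)
    ≡⟨ cong (subVNF (inst (nomc ι kf)) nomc) (sym (subVNF-subVNF θ nomc var (permNames πh) B)) ⟩
      subVNF (inst (nomc ι kf)) nomc (subVNF θ nomc (subVNF var (permNames πh) B))
    ≡⟨ sym (trans (subF-as-subVN _ _) (cong (subVNF (inst (nomc ι kf)) nomc) (trans (subF-as-subVN θ _) (cong (subVNF θ nomc) (permF-as-subVN πh B))))) ⟩
      subF (inst (nomc ι kf)) (subF θ (permF πh B))
    ∎ where
    open ≡-Reasoning
    σ = swapP ι (fι πh aB) kf ∘P (πh ∘P invP πB)
    σ-aB : Perm.f σ ι (fι πB aB) ≡ kf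
    σ-aB = trans (cong (λ z → swf ι (fι πh aB) kf ι (Perm.f πh ι z)) (Perm.gf πB ι aB))
                (trans (swf-same ι (fι πh aB) kf (fι πh aB)) (swℕ-m (fι πh aB) kf))
    σ-fixes-B : ∀ ι' k → occF (ι' , k) B → Perm.f σ ι' (Perm.f πB ι' k) ≡ Perm.f πh ι' k
    σ-fixes-B ι' k o = trans (cong (λ z → swf ι (fι πh aB) kf ι' (Perm.f πh ι' z)) (Perm.gf πB ι' k))
       (swf-fix ι (fι πh aB) kf ι' (Perm.f πh ι' k)
          (λ e → nB (subst (λ z → occF z B) (cong₂ _,_ (cong proj₁ e) (f-injective πh _ (trans (cong proj₂ e) (cong (λ z → Perm.f πh z aB) (sym (cong proj₁ e)))))) o))
          (λ e → fr (subst (λ z → occF z (permF πh B)) e (occ-perm⁺ πh B ι' k o))))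

  trF-idπ : ∀ {Γ Δ} (θ : Sub Γ (nom ι ∷ Δ)) → NomFreeSub θ → (πh π' : Perm) (B C : Fm Γ) →
    (πB : Perm) (aB : ℕ) → ¬ occF (ι , aB) B → (π₀ : Perm) (a₀ : ℕ) → ¬ occF (ι , a₀) C →
    permF πh B ≈F permF π' C →
    Σ[ σ ∈ Perm ] Σ[ σ₂ ∈ Perm ] (permF σ (trF θ (πB , aB) B) ≈F permF σ₂ (trF θ (π₀ , a₀) C))
  trF-idπ θ nθ πh π' B C πB aB nB π₀ a₀ nC p =
    _ , _ , ≡-≈F (trF-align θ nθ πh πB aB B nB kf frB)
            (≈F-≡ (≈F-subF (inst (nomc ι kf)) (≈F-subF θ p)) (sym (trF-align θ nθ π' π₀ a₀ C nC kf frC)))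
    where
    kf = fresh (maxF (permF πh B)) (maxF (permF π' C))
    frB : ¬ occF (ι , kf) (permF πh B)
    frB o = fresh-≢ˡ _ _ (maxF-ok (permF πh B) ι kf o) refl
    frC : ¬ occF (ι , kf) (permF π' C)
    frC o = fresh-≢ʳ _ _ (maxF-ok (permF π' C) ι kf o) refl

  trBody : ∀ {Γ Δ τ} → Sub Γ (nom ι ∷ Δ) → Ann → Fm (τ ∷ Γ) → Fm (τ ∷ Δ)
  trBody θ (π , a) Q = permF π (subF (extS (inst (nomc ι a))) (subF (extS θ) Q))

  trBody-as-subVN : ∀ {Γ Δ τ} (θ : Sub Γ (nom ι ∷ Δ)) → NomFreeSub θ → (π : Perm) (a : ℕ) (Q : Fm (τ ∷ Γ)) →
    trBody θ (π , a) Q ≡ subVNF (extS (closeAt θ (fι π a))) (permNames π) Q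
  trBody-as-subVN θ nθ π a Q = begin
      permF π (subF (extS (inst (nomc ι a))) (subF (extS θ) Q))
    ≡⟨ trans (permF-as-subVN π _) (cong (subVNF var (permNames π)) (trans (subF-as-subVN _ _) (cong (subVNF (extS (inst (nomc ι a))) nomc) (subF-as-subVN (extS θ) Q)))) ⟩
      subVNF var (permNames π) (subVNF (extS (inst (nomc ι a))) nomc (subVNF (extS θ) nomc Q))
    ≡⟨ cong (subVNF var (permNames π)) (subVNF-subVNF (extS (inst (nomc ι a))) nomc (extS θ) nomc Q) ⟩
      subVNF var (permNames π) (subVNF (λ v → subVN (extS (inst (nomc ι a))) nomc (extS θ v)) (λ ι' k → nomc ι' k) Q)
    ≡⟨ subVNF-subVNF var (permNames π) _ _ Q ⟩
      subVNF (λ v → subVN var (permNames π) (subVN (extS (inst (nomc ι a))) nomc (extS θ v))) (λ ι' k → nomc ι' (Perm.f π ι' k)) Q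
    ≡⟨ subVNF-cong (λ { here → refl ; (there v) → wk-closeAt v }) (λ ι' k → refl) Q ⟩
      subVNF (extS (closeAt θ (fι π a))) (permNames π) Q
    ∎ where
    open ≡-Reasoning
    wk-closeAt : ∀ {τ'} (v : Var _ τ') → subVN var (permNames π) (subVN (extS (inst (nomc ι a))) nomc (ren there (θ v))) ≡ ren there (closeAt θ (fι π a) v)
    wk-closeAt v = begin
        subVN var (permNames π) (subVN (extS (inst (nomc ι a))) nomc (ren there (θ v)))
      ≡⟨ cong (subVN var (permNames π)) (subVN-wk (inst (nomc ι a)) nomc (θ v)) ⟩
        subVN var (permNames π) (ren there (subVN (inst (nomc ι a)) nomc (θ v)))
      ≡⟨ subVN-ren var (permNames π) there (subVN (inst (nomc ι a)) nomc (θ v)) ⟩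
        subVN (λ w → var (there w)) (permNames π) (subVN (inst (nomc ι a)) nomc (θ v))
      ≡⟨ sym (ren-subVN there var (permNames π) (subVN (inst (nomc ι a)) nomc (θ v))) ⟩
        ren there (subVN var (permNames π) (subVN (inst (nomc ι a)) nomc (θ v)))
      ≡⟨ cong (ren there) (trans (cong (subVN var (permNames π)) (sym (sub-as-subVN _ (θ v)))) (perm-closeAt π a (θ v) (nθ v))) ⟩
        ren there (closeAt θ (fι π a) v)
      ∎

  -- For a, f ∉ supp(B), trF θ (swapAnn π a f) B is trF θ (π , a) B: this is how the name standing
  -- for x is exchanged for one that is fresh for a term introduced by the rule.
  swapAnn : Perm → ℕ → ℕ → Ann
  swapAnn π a f = (π ∘P swapP ι a f , f)

  fι-swap : ∀ π a f → fι (π ∘P swapP ι a f) f ≡ fι π a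
  fι-swap π a f = cong (Perm.f π ι) (trans (swf-same ι a f f) (swℕ-n a f))

  permNames-swap : ∀ {Γ} π a f ι' k → ¬ (ι' , k) ≡ (ι , a) → ¬ (ι' , k) ≡ (ι , f) → permNames {Γ} (π ∘P swapP ι a f) ι' k ≡ permNames π ι' k
  permNames-swap π a f ι' k p q = cong (λ z → nomc ι' (Perm.f π ι' z)) (swf-fix ι a f ι' k p q)

  trF-inst : ∀ {Γ Δ τ} (θ : Sub Γ (nom ι ∷ Δ)) → NomFreeSub θ → (π : Perm) (a f : ℕ) (Q : Fm (τ ∷ Γ)) (t : Tm Γ τ) →
    ¬ occF (ι , a) Q → ¬ occF (ι , f) Q →
    trF θ (swapAnn π a f) (subF (inst t) Q) ≡ subF (inst (subVN (closeAt θ (fι π a)) (permNames (π ∘P swapP ι a f)) t)) (trBody θ (π , a) Q)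
  trF-inst θ nθ π a f Q t na nf = begin
      trF θ (swapAnn π a f) (subF (inst t) Q)
    ≡⟨ trF-as-subVN θ nθ π' f _ ⟩
      subVNF (closeAt θ (fι π' f)) (permNames π') (subF (inst t) Q)
    ≡⟨ cong (subVNF (closeAt θ (fι π' f)) (permNames π')) (subF-as-subVN (inst t) Q) ⟩
      subVNF (closeAt θ (fι π' f)) (permNames π') (subVNF (inst t) nomc Q)
    ≡⟨ subVNF-subVNF (closeAt θ (fι π' f)) (permNames π') (inst t) nomc Q ⟩
      subVNF (λ v → subVN (closeAt θ (fι π' f)) (permNames π') (inst t v)) (permNames π') Q
    ≡⟨ subVNF-cong-occ Q (λ { here _ → cong (λ z → subVN (closeAt θ z) (permNames π') t) (fι-swap π a f)
                           ; (there v) _ → trans (cong (λ z → closeAt θ z v) (fι-swap π a f)) (sym (inst-wk t' (closeAt θ (fι π a) v))) })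
                        (λ ι' k o → permNames-swap π a f ι' k (λ e → na (subst (λ z → occF z Q) e o)) (λ e → nf (subst (λ z → occF z Q) e o))) ⟩
      subVNF (λ v → subVN (inst t') nomc (extS (closeAt θ (fι π a)) v)) (λ ι' k → subVN (inst t') nomc (permNames π ι' k)) Q
    ≡⟨ sym (subVNF-subVNF (inst t') nomc (extS (closeAt θ (fι π a))) (permNames π) Q) ⟩
      subVNF (inst t') nomc (subVNF (extS (closeAt θ (fι π a))) (permNames π) Q)
    ≡⟨ sym (trans (subF-as-subVN (inst t') _) (cong (subVNF (inst t') nomc) (trBody-as-subVN θ nθ π a Q))) ⟩
      subF (inst t') (trBody θ (π , a) Q)
    ∎ where
    open ≡-Reasoning
    π' = π ∘P swapP ι a f
    t' = subVN (closeAt θ (fι π a)) (permNames π') t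

  fresh-inst : ∀ {Γ τ} (f : ℕ) (Q : Fm (τ ∷ Γ)) (t : Tm Γ τ) → ¬ occF (ι , f) Q → ¬ occT (ι , f) t → ¬ occF (ι , f) (subF (inst t) Q)
  fresh-inst f Q t nQ nt o with occF-subVN⁻ _ (inst t) nomc Q (subst (occF _) (subF-as-subVN (inst t) Q) o)
  ... | inj₁ (_ , here , o') = nt o'
  ... | inj₁ (_ , there v , ())
  ... | inj₂ (ι' , k , oc , o') = nQ (subst (λ z → occF z Q) o' oc)

  trF-subF : ∀ {Γ Γ' Δ} (θ : Sub Γ (nom ι ∷ Δ)) → NomFreeSub θ → (π : Perm) (a : ℕ) (σ : Sub Γ' Γ) (B : Fm Γ') →
    trF θ (π , a) (subF σ B) ≡ subVNF (λ v → subVN (closeAt θ (fι π a)) (permNames π) (σ v)) (permNames π) B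
  trF-subF θ nθ π a σ B = trans (trF-as-subVN θ nθ π a (subF σ B)) (trans (cong (subVNF (closeAt θ (fι π a)) (permNames π)) (subF-as-subVN σ B)) (subVNF-subVNF (closeAt θ (fι π a)) (permNames π) σ nomc B))

  trT-succ : ∀ {Γ Δ} (θ : Sub Γ (nom ι ∷ Δ)) → NomFreeSub θ → (π : Perm) (a f : ℕ) (t I : Tm Γ num) →
    ¬ occT (ι , a) t → ¬ occT (ι , f) t → t ≈ app sc I →
    trT θ (π , a) t ≈ app sc (trT θ (swapAnn π a f) I)
  trT-succ θ nθ π a f t I na nf p =
    ≡-≈ (trans (trT-as-subVN θ nθ π a t) (subVN-cong-occ t (λ v _ → cong (λ z → closeAt θ z v) (sym (fι-swap π a f)))
          (λ ι' k o → sym (permNames-swap π a f ι' k (λ e → na (subst (λ z → occT z t) e o)) (λ e → nf (subst (λ z → occT z t) e o))))))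
     (≈-≡ (≈-subVN (closeAt θ (fι π' f)) (permNames π') p) (cong (app sc) (sym (trT-as-subVN θ nθ π' f I))))
    where π' = π ∘P swapP ι a f

  occ-trBody⁺ : ∀ {Γ Δ τ} (θ : Sub Γ (nom ι ∷ Δ)) → NomFreeSub θ → (π : Perm) (a : ℕ) (Q : Fm (τ ∷ Γ)) (ι₀ k₀ : ℕ) →
    occF (ι₀ , k₀) Q → occF (ι₀ , Perm.f π ι₀ k₀) (trBody θ (π , a) Q)
  occ-trBody⁺ θ nθ π a Q ι₀ k₀ o = subst (occF _) (sym (trBody-as-subVN θ nθ π a Q)) (occF-subVN⁺ _ _ (permNames π) Q ι₀ k₀ o refl)

  -- The name k chosen by ∇ may be the image of x; it is replaced by k', fresh for the translated
  -- body, and π is post-composed with the transposition of π k and k'.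
  module Nab {Γ Δ} (θ : Sub Γ (nom ι ∷ Δ)) (nθ : NomFreeSub θ) (π : Perm) (a : ℕ) (ι' k : ℕ) (B : Fm (nom ι' ∷ Γ))
             (nk : ¬ occF (ι' , k) B) (na : ¬ occF (ι , a) B) where
    T : Fm (nom ι' ∷ Δ)
    T = trBody θ (π , a) B
    k' : ℕ
    k' = fresh (maxF T) (fι π a)
    ρ : Perm
    ρ = swapP ι' (Perm.f π ι' k) k'
    π' : Perm
    π' = ρ ∘P π
    a' : ℕ
    a' = Perm.g π' ι (fι π a)
    c' : Ann
    c' = (π' , a')

    k'-fresh : ¬ occF (ι' , k') T
    k'-fresh = freshˡ-F ι' T (fι π a)

    fι-a' : fι π' a' ≡ fι π a
    fι-a' = Perm.fg π' ι (fι π a)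

    ρ-fixes-B : ∀ ι₀ k₀ → occF (ι₀ , k₀) B → Perm.f ρ ι₀ (Perm.f π ι₀ k₀) ≡ Perm.f π ι₀ k₀
    ρ-fixes-B ι₀ k₀ o = swf-fix ι' (Perm.f π ι' k) k' ι₀ (Perm.f π ι₀ k₀)
       (λ e → nk (subst (λ z → occF z B) (cong₂ _,_ (cong proj₁ e) (f-injective π ι' (trans (cong (λ z → Perm.f π z k₀) (sym (cong proj₁ e))) (cong proj₂ e)))) o))
       (λ e → fresh-≢ˡ (maxF T) _ (maxF-ok T ι₀ _ (occ-trBody⁺ θ nθ π a B ι₀ k₀ o)) (cong proj₂ e))

    trF-nab : trF θ c' (subF (inst (nomc ι' k)) B) ≡ subF (inst (nomc ι' k')) T
    trF-nab = begin
        trF θ c' (subF (inst (nomc ι' k)) B)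
      ≡⟨ trF-subF θ nθ π' a' (inst (nomc ι' k)) B ⟩
        subVNF (λ v → subVN (closeAt θ (fι π' a')) (permNames π') (inst (nomc ι' k) v)) (permNames π') B
      ≡⟨ subVNF-cong-occ B (λ { here _ → cong (nomc ι') (trans (swf-same ι' (Perm.f π ι' k) k' (Perm.f π ι' k)) (swℕ-m (Perm.f π ι' k) k'))
                             ; (there v) _ → trans (cong (λ z → closeAt θ z v) fι-a') (sym (inst-wk (nomc ι' k') (closeAt θ (fι π a) v))) })
                          (λ ι₀ k₀ o → cong (nomc ι₀) (ρ-fixes-B ι₀ k₀ o)) ⟩
        subVNF (λ v → subVN (inst (nomc ι' k')) nomc (extS (closeAt θ (fι π a)) v)) (λ ι₀ k₀ → subVN (inst (nomc ι' k')) nomc (permNames π ι₀ k₀)) B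
      ≡⟨ sym (subVNF-subVNF (inst (nomc ι' k')) nomc (extS (closeAt θ (fι π a))) (permNames π) B) ⟩
        subVNF (inst (nomc ι' k')) nomc (subVNF (extS (closeAt θ (fι π a))) (permNames π) B)
      ≡⟨ sym (trans (subF-as-subVN (inst (nomc ι' k')) T) (cong (subVNF (inst (nomc ι' k')) nomc) (trBody-as-subVN θ nθ π a B))) ⟩
        subF (inst (nomc ι' k')) T
      ∎ where open ≡-Reasoning

    a'-fresh : ¬ occF (ι , a') (subF (inst (nomc ι' k)) B)
    a'-fresh o with occF-subVN⁻ _ (inst (nomc ι' k)) nomc B (subst (occF _) (subF-as-subVN _ B) o)
    ... | inj₁ (_ , there v , ())
    ... | inj₁ (_ , here , e) = h (cong proj₁ e) (cong proj₂ e)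
      where
      h : ι' ≡ ι → k ≡ a' → ⊥
      h refl e₂ = fresh-≢ʳ (maxF T) (fι π a) NP.≤-refl
                      (trans (sym fι-a') (trans (cong (fι π') (sym e₂)) (trans (swf-same ι (Perm.f π ι k) k' (Perm.f π ι k)) (swℕ-m (Perm.f π ι k) k'))))
    ... | inj₂ (ι₀ , k₀ , oc , e) = a'∉B e oc
      where
      a'∉B : (ι₀ , k₀) ≡ (ι , a') → occF (ι₀ , k₀) B → ⊥
      a'∉B refl oc = na (subst (λ z → occF (ι , z) B) (f-injective π ι (trans (sym (ρ-fixes-B ι a' oc)) fι-a')) oc)

  wkUnder : ∀ {Δ X} → Ren (nom ι ∷ Δ) (nom ι ∷ X ∷ Δ)
  wkUnder here = here
  wkUnder (there w) = there (there w)

  wkUnder-inst : ∀ {Δ X τ} (m : ℕ) (u : Tm (nom ι ∷ Δ) τ) →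
    sub (inst (nomc ι m)) (ren (wkUnder {X = X}) u) ≡ subVN (λ w → var (there w)) nomc (sub (inst (nomc ι m)) u)
  wkUnder-inst m u = trans (sub-as-subVN (inst (nomc ι m)) (ren wkUnder u)) (trans (subVN-ren (inst (nomc ι m)) nomc wkUnder u)
    (trans (subVN-cong (λ { here → refl ; (there w) → refl }) (λ _ _ → refl) u)
           (sym (trans (cong (subVN _ nomc) (sub-as-subVN _ u)) (subVN-subVN _ nomc (inst (nomc ι m)) nomc u)))))

  module ListsPerm {Γ Δ} (Q : Fm Γ) (E : Fm Δ) (π : Perm) (a : ℕ) (cs : List NomC) (uniq : Unique cs)
                   (supp : ∀ c → (c ∈ cs → occF c Q) × (occF c Q → c ∈ cs)) (na : ¬ occF (ι , a) Q)
                   (occ⁺ : ∀ ι' k → occF (ι' , k) Q → occF (ι' , Perm.f π ι' k) E)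
                   (occ⁻ : ∀ b → occF b E → (b ≡ (ι , fι π a)) ⊎ (Σ[ c ∈ NomC ] (occF c Q × b ≡ πN π c))) where
    mem→occ : ∀ b → b ∈ map (πN π) cs → occF b E
    mem→occ b mem with ∈-map⁻ (πN π) mem
    ... | (ι' , k) , mcs , refl = occ⁺ ι' k (proj₁ (supp (ι' , k)) mcs)

    occ→ : ∀ b → occF b E → (b ≡ (ι , fι π a)) ⊎ (b ∈ map (πN π) cs)
    occ→ b o with occ⁻ b o
    ... | inj₁ e = inj₁ e
    ... | inj₂ (c , oc , refl) = inj₂ (∈-map⁺ (πN π) (proj₂ (supp c) oc))

    uniq' : Unique (map (πN π) cs)
    uniq' = UP.map⁺ (πN-injective π) uniq

    m∉ : ∀ {y} → y ∈ map (πN π) cs → ¬ (ι , fι π a) ≡ y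
    m∉ ym e with ∈-map⁻ (πN π) ym
    ... | c , mcs , refl = na (subst (λ z → occF z Q) (sym (πN-injective π {c₁ = (ι , a)} e)) (proj₁ (supp c) mcs))

  occ-trBody⁻ : ∀ {Γ Δ τ} (θ : Sub Γ (nom ι ∷ Δ)) → NomFreeSub θ → (π : Perm) (a : ℕ) (Q : Fm (τ ∷ Γ)) (b : NomC) →
    occF b (trBody θ (π , a) Q) → (b ≡ (ι , fι π a)) ⊎ (Σ[ c ∈ NomC ] (occF c Q × b ≡ πN π c))
  occ-trBody⁻ θ nθ π a Q b o with occF-subVN⁻ b (extS (closeAt θ (fι π a))) (permNames π) Q (subst (occF b) (trBody-as-subVN θ nθ π a Q) o)
  ... | inj₁ (_ , here , ())
  ... | inj₁ (_ , there v , o') = inj₁ (occ-closeAt θ nθ (fι π a) b v (occ-ren⁻ b there (closeAt θ (fι π a) v) o'))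
  ... | inj₂ (ι' , k , oc , o') = inj₂ ((ι' , k) , oc , sym o')

  Lists-πN : ∀ {Γ Δ} (Q : Fm Γ) (E : Fm Δ) (π : Perm) (a : ℕ) (cs : List NomC) → Lists cs Q → ¬ occF (ι , a) Q →
    (∀ ι' k → occF (ι' , k) Q → occF (ι' , Perm.f π ι' k) E) →
    (∀ b → occF b E → (b ≡ (ι , fι π a)) ⊎ (Σ[ c ∈ NomC ] (occF c Q × b ≡ πN π c))) →
    (d : Dec (occF (ι , fι π a) E)) → Lists (consIf d (ι , fι π a) (map (πN π) cs)) E
  Lists-πN Q E π a cs (uniq , supp) na occ⁺ occ⁻ (yes m∈E) =
    (All.tabulate m∉ ∷ uniq') , λ b → (λ { (here refl) → m∈E ; (there mem) → mem→occ b mem }) ,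
                                     (λ o → [ (λ e → here e) , there ] (occ→ b o))
    where
    open ListsPerm Q E π a cs uniq supp na occ⁺ occ⁻
  Lists-πN Q E π a cs (uniq , supp) na occ⁺ occ⁻ (no m∉E) =
    uniq' , λ b → mem→occ b , (λ o → [ (λ e → ⊥-elim (m∉E (subst (λ z → occF z E) e o))) , (λ x → x) ] (occ→ b o))
    where
    open ListsPerm Q E π a cs uniq supp na occ⁺ occ⁻

  -- If the image m of x occurs in the translated body, the new eigenvariable h is raised over m as
  -- well: θ↑ sends the old eigenvariable to X = h x, which becomes h m once x is instantiated.
  module Raising {Γ Δ τ} (θ : Sub Γ (nom ι ∷ Δ)) (nθ : NomFreeSub θ) (π : Perm) (a : ℕ) (Q : Fm (τ ∷ Γ))
               (cs : List NomC) (ls : Lists cs (all τ Q)) (na : ¬ occF (ι , a) Q) where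
    T : Fm (τ ∷ Δ)
    T = trBody θ (π , a) Q
    m : ℕ
    m = fι π a

    occ? : Dec (occF (ι , m) T)
    occ? = occF? (ι , m) T

    cs' : List NomC
    cs' = consIf occ? (ι , m) (map (πN π) cs)

    X : Tm (nom ι ∷ raise cs' τ ∷ Δ) (raise (map (πN π) cs) τ)
    X with occ?
    ... | yes _ = app (var (there here)) (var here)
    ... | no _ = var (there here)

    θ↑ : Sub (raise cs τ ∷ Γ) (nom ι ∷ raise cs' τ ∷ Δ)
    θ↑ here = subst (Tm _) (raise-map-πN π cs τ) X
    θ↑ (there v) = ren wkUnder (θ v)

    nomFree-X : NomFreeTm X
    nomFree-X with occ?
    ... | yes _ = λ b → λ { (inj₁ ()) ; (inj₂ ()) }
    ... | no _ = λ b ()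

    nθ↑ : NomFreeSub θ↑
    nθ↑ here b o = nomFree-X b (occ-subst b (raise-map-πN π cs τ) X o)
    nθ↑ (there v) b o = nomFree-ren wkUnder (θ v) (nθ v) b o

    X-at-m : appNoms (map (πN π) cs) (sub (inst (nomc ι m)) X) ≡ appNoms cs' (var here)
    X-at-m with occ?
    ... | yes _ = refl
    ... | no _ = refl

    trF-wk : ∀ (c : Ann) (B : Fm Γ) → trF θ↑ c (wkF B) ≡ wkF (trF θ c B)
    trF-wk (π₁ , a₁) B = begin
        trF θ↑ (π₁ , a₁) (renF there B)
      ≡⟨ trans (cong (trF θ↑ (π₁ , a₁)) (trans (renF-as-subVN there B) (sym (subF-as-subVN (λ v → var (there v)) B)))) (trF-subF θ↑ nθ↑ π₁ a₁ (λ v → var (there v)) B) ⟩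
        subVNF (λ v → closeAt θ↑ (fι π₁ a₁) (there v)) (permNames π₁) B
      ≡⟨ subVNF-cong (λ v → wkUnder-inst (fι π₁ a₁) (θ v)) (λ _ _ → refl) B ⟩
        subVNF (λ v → subVN (λ w → var (there w)) nomc (closeAt θ (fι π₁ a₁) v)) (λ ι' k → subVN (λ w → var (there w)) nomc (permNames π₁ ι' k)) B
      ≡⟨ sym (subVNF-subVNF (λ w → var (there w)) nomc (closeAt θ (fι π₁ a₁)) (permNames π₁) B) ⟩
        subVNF (λ w → var (there w)) nomc (subVNF (closeAt θ (fι π₁ a₁)) (permNames π₁) B)
      ≡⟨ sym (trans (renF-as-subVN there _) (cong (subVNF (λ w → var (there w)) nomc) (trF-as-subVN θ nθ π₁ a₁ B))) ⟩
        renF there (trF θ (π₁ , a₁) B)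
      ∎ where open ≡-Reasoning

    trF-raise : trF θ↑ (π , a) (subF (raiseSub cs) Q) ≡ subF (raiseSub cs') T
    trF-raise = begin
        trF θ↑ (π , a) (subF (raiseSub cs) Q)
      ≡⟨ trF-subF θ↑ nθ↑ π a (raiseSub cs) Q ⟩
        subVNF (λ v → subVN (closeAt θ↑ m) (permNames π) (raiseSub cs v)) (permNames π) Q
      ≡⟨ subVNF-cong (λ { here → hereEq ; (there v) → trans (wkUnder-inst m (θ v)) (sym (subVN-ren (raiseSub cs') nomc there (closeAt θ m v))) }) (λ _ _ → refl) Q ⟩
        subVNF (λ v → subVN (raiseSub cs') nomc (extS (closeAt θ m) v)) (λ ι' k → subVN (raiseSub cs') nomc (permNames π ι' k)) Q
      ≡⟨ sym (subVNF-subVNF (raiseSub cs') nomc (extS (closeAt θ m)) (permNames π) Q) ⟩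
        subVNF (raiseSub cs') nomc (subVNF (extS (closeAt θ m)) (permNames π) Q)
      ≡⟨ sym (trans (subF-as-subVN (raiseSub cs') T) (cong (subVNF (raiseSub cs') nomc) (trBody-as-subVN θ nθ π a Q))) ⟩
        subF (raiseSub cs') T
      ∎ where
      open ≡-Reasoning
      hereEq : subVN (closeAt θ↑ m) (permNames π) (appNoms cs (var here)) ≡ appNoms cs' (var here)
      hereEq = trans (appNoms-perm (closeAt θ↑ m) π cs (var here))
        (trans (cong (λ z → appNoms (map (πN π) cs) (subst (Tm _) (sym (raise-map-πN π cs τ)) z)) (sub-subst (inst (nomc ι m)) (raise-map-πN π cs τ) X))
        (trans (cong (appNoms (map (πN π) cs)) (subst-sym-subst (raise-map-πN π cs τ))) X-at-m))

    a-fresh : ¬ occF (ι , a) (subF (raiseSub cs) Q)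
    a-fresh = fresh-subF (raiseSub cs) (ι , a) Q na h
      where
      h : ∀ {τ'} (v : Var (τ ∷ Γ) τ') → ¬ occT (ι , a) (raiseSub cs v)
      h here o with occ-appNoms (ι , a) cs (var here) o
      ... | inj₁ ()
      ... | inj₂ mem = na (proj₁ (proj₂ ls (ι , a)) mem)
      h (there v) ()

    ls' : Lists cs' (all τ T)
    ls' = Lists-πN (all τ Q) (all τ T) π a cs ls na (occ-trBody⁺ θ nθ π a Q) (occ-trBody⁻ θ nθ π a Q) occ?

  absAt-inst : ∀ {Δ τ} (π : Perm) (a : ℕ) (W : Tm (nom ι ∷ Δ) τ) → ¬ occT (ι , a) W →
    absAt ι (fι π a) there here (permT π (sub (inst (nomc ι a)) W)) ≡ permT π W
  absAt-inst π a W na = begin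
      absAt ι (fι π a) there here (permT π (sub (inst (nomc ι a)) W))
    ≡⟨ trans (absAt-as-subVN ι (fι π a) there here (permT π (sub (inst (nomc ι a)) W))) (cong (subVN (λ v → var (there v)) (nameToVar ι (fι π a) here)) (trans (permT-as-subVN π (sub (inst (nomc ι a)) W)) (cong (subVN var (permNames π)) (sub-as-subVN (inst (nomc ι a)) W)))) ⟩
      subVN (λ v → var (there v)) (nameToVar ι (fι π a) here) (subVN var (permNames π) (subVN (inst (nomc ι a)) nomc W))
    ≡⟨ cong (subVN _ _) (subVN-subVN var (permNames π) (inst (nomc ι a)) nomc W) ⟩
      subVN (λ v → var (there v)) (nameToVar ι (fι π a) here) (subVN (λ v → subVN var (permNames π) (inst (nomc ι a) v)) (permNames π) W)
    ≡⟨ subVN-subVN _ _ _ _ W ⟩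
      subVN (λ v → subVN (λ w → var (there w)) (nameToVar ι (fι π a) here) (subVN var (permNames π) (inst (nomc ι a) v))) (λ ι' k → nameToVar ι (fι π a) here ι' (Perm.f π ι' k)) W
    ≡⟨ subVN-cong-occ W (λ { here _ → nameToVar-hit ι (fι π a) here ; (there w) _ → refl })
         (λ ι' k o → nameToVar-miss ι _ here ι' _ (λ e → na (subst (λ z → occT z W) (sym (πN-injective π e)) o))) ⟩
      subVN var (permNames π) W
    ≡⟨ sym (permT-as-subVN π W) ⟩
      permT π W
    ∎ where open ≡-Reasoning

  module EqL {Γ Δ τ} (θ : Sub Γ (nom ι ∷ Δ)) (nθ : NomFreeSub θ) (π : Perm) (a : ℕ) (s t : Tm Γ τ)
             (cs : List NomC) (ls : Lists cs (eq τ s t)) (na : ¬ occF (ι , a) (eq τ s t)) where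
    D₀ : Fm Γ
    D₀ = eq τ s t
    E' : Fm Δ
    E' = trF θ (π , a) D₀
    m : ℕ
    m = fι π a

    occ? : Dec (occF (ι , m) E')
    occ? = occF? (ι , m) E'

    cs' : List NomC
    cs' = consIf occ? (ι , m) (map (πN π) cs)

    ls' : Lists cs' E'
    ls' = Lists-πN D₀ E' π a cs ls na (occ-trF⁺ θ nθ π a D₀) (occ-trF⁻ θ nθ π a D₀) occ?

    θ⇑ : ∀ {Σ'} → Sub Δ Σ' → Sub Γ (nom ι ∷ Σ')
    θ⇑ θ' v = sub (extS θ') (θ v)

    nθ⇑ : ∀ {Σ'} (θ' : Sub Δ Σ') → NomFreeSub θ' → NomFreeSub (θ⇑ θ')
    nθ⇑ θ' nθ' v b o = nomFree-subVN (extS θ') nomc (θ v) (nomFreeSub-extS θ' nθ') (nθ v) b (subst (occT b) (sub-as-subVN (extS θ') (θ v)) o)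

    θ⇑-absN : ∀ {Σ'} (θ' : Sub Δ Σ') → NomFreeSub θ' → (x : Tm Γ τ) → sub (θ⇑ θ') (absN cs x) ≡ sub (extS θ') (absN cs (sub θ x))
    θ⇑-absN θ' nθ' x = trans (absN-sub (θ⇑ θ') (nθ⇑ θ' nθ') cs x)
      (trans (cong (absN cs) (sym (sub-sub (extS θ') θ x))) (sym (absN-sub (extS θ') (nomFreeSub-extS θ' nθ') cs (sub θ x))))

    raise≡ : raise (map (πN π) cs) τ ≡ raise cs τ
    raise≡ = raise-map-πN π cs τ

    absN-permT : ∀ {Γ'} (u : Tm Γ' τ) → absN (map (πN π) cs) (permT π u) ≡ subst (Tm Γ') (sym raise≡) (permT π (absN cs u))
    absN-permT u = trans (sym (subst-sym-subst raise≡)) (cong (subst (Tm _) (sym raise≡)) (sym (absN-perm π cs u)))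

    unused-x : ∀ (x : Tm Γ τ) → ¬ occT (ι , m) (trT θ (π , a) x) → ¬ voccT zero (sub θ x)
    unused-x x m∉ vo = m∉ (subst (occT (ι , m)) (sym (permT-as-subVN π (sub (inst (nomc ι a)) (sub θ x))))
       (occ-subVN⁺ (ι , m) var (permNames π) (sub (inst (nomc ι a)) (sub θ x)) ι a
          (subst (occT (ι , a)) (sym (sub-as-subVN (inst (nomc ι a)) (sub θ x))) (occ-vocc (ι , a) (inst (nomc ι a)) nomc (sub θ x) here vo refl)) refl))

    sub-inst-unused : ∀ {Σ'} (θ' : Sub Δ Σ') (W : Tm (nom ι ∷ Δ) τ) → ¬ voccT zero W →
      sub wkSub (sub θ' (sub (inst (nomc ι a)) W)) ≡ sub (extS θ') W
    sub-inst-unused θ' W nv = trans (sub-sub wkSub θ' (sub (inst (nomc ι a)) W)) (trans (sub-sub _ (inst (nomc ι a)) W) (trans (sub-as-subVN _ W)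
       (trans (subVN-cong-occ W (λ { here vo → ⊥-elim (nv vo) ; (there w) _ → trans (sub-as-subVN wkSub (θ' w)) (sym (ren-as-subVN there (θ' w))) }) (λ _ _ _ → refl))
              (sym (sub-as-subVN (extS θ') W)))))

    unifier-back : ∀ {Σ'} (θ' : Sub Δ Σ') → NomFreeSub θ' →
      sub θ' (absN cs' (trT θ (π , a) s)) ≈ sub θ' (absN cs' (trT θ (π , a) t)) →
      sub (θ⇑ θ') (absN cs s) ≈ sub (θ⇑ θ') (absN cs t)
    unifier-back θ' nθ' u with occ?
    -- m is abstracted outermost: stripping that λ and the permutation leaves the original equation.
    ... | yes _ = ≡-≈ (θ⇑-absN θ' nθ' s) (≈-≡ instances≈ (sym (θ⇑-absN θ' nθ' t)))
      where
      absN-trT : ∀ (x : Tm Γ τ) → ¬ occT (ι , a) x →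
        sub θ' (absN ((ι , m) ∷ map (πN π) cs) (trT θ (π , a) x)) ≡ lam (sub (extS θ') (subst (Tm _) (sym raise≡) (permT π (absN cs (sub θ x)))))
      absN-trT x a∉x = cong (λ z → lam (sub (extS θ') z)) (trans (cong (absN (map (πN π) cs)) (absAt-inst π a (sub θ x) (fresh-sub-nomFree θ nθ (ι , a) x a∉x))) (absN-permT (sub θ x)))
      lams≈ = ≡-≈ (sym (absN-trT s (λ o → na (inj₁ o)))) (≈-≡ u (absN-trT t (λ o → na (inj₂ o))))
      bodies≈ = lam-inj lams≈
      unperm≈ = ≈-subst⁻ (sym raise≡) (≡-≈ (sym (sub-subst (extS θ') (sym raise≡) _)) (≈-≡ bodies≈ (sub-subst (extS θ') (sym raise≡) _)))
      instances≈ : sub (extS θ') (absN cs (sub θ s)) ≈ sub (extS θ') (absN cs (sub θ t))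
      instances≈ = ≈-permT⁻ π (≡-≈ (sym (sub-permT-nomFree (extS θ') (nomFreeSub-extS θ' nθ') π (absN cs (sub θ s)))) (≈-≡ unperm≈ (sub-permT-nomFree (extS θ') (nomFreeSub-extS θ' nθ') π (absN cs (sub θ t)))))
    -- m does not occur, so x does not occur in θ s and θ t, and instantiating it by a loses nothing.
    ... | no noc = ≡-≈ (θ⇑-absN-wk s (λ o → noc (inj₁ o))) (≈-≡ instances≈ (sym (θ⇑-absN-wk t (λ o → noc (inj₂ o)))))
      where
      inst-a : Tm Γ τ → Tm Δ τ
      inst-a x = sub (inst (nomc ι a)) (sub θ x)
      unperm≈ = ≈-subst⁻ (sym raise≡) (≡-≈ (sym (trans (cong (sub θ') (absN-permT (inst-a s))) (sub-subst θ' (sym raise≡) _)))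
                              (≈-≡ u (trans (cong (sub θ') (absN-permT (inst-a t))) (sub-subst θ' (sym raise≡) _))))
      bodies≈ : sub θ' (absN cs (inst-a s)) ≈ sub θ' (absN cs (inst-a t))
      bodies≈ = ≈-permT⁻ π (≡-≈ (sym (sub-permT-nomFree θ' nθ' π (absN cs (inst-a s)))) (≈-≡ unperm≈ (sub-permT-nomFree θ' nθ' π (absN cs (inst-a t)))))
      instances≈ : subVN wkSub nomc (sub θ' (absN cs (inst-a s))) ≈ subVN wkSub nomc (sub θ' (absN cs (inst-a t)))
      instances≈ = ≈-subVN wkSub nomc bodies≈
      θ⇑-absN-wk : ∀ (x : Tm Γ τ) → ¬ occT (ι , m) (trT θ (π , a) x) →
        sub (θ⇑ θ') (absN cs x) ≡ subVN wkSub nomc (sub θ' (absN cs (inst-a x)))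
      θ⇑-absN-wk x m∉ = trans (θ⇑-absN θ' nθ' x) (trans (absN-sub (extS θ') (nomFreeSub-extS θ' nθ') cs _)
        (trans (cong (absN cs) (sym (sub-inst-unused θ' (sub θ x) (unused-x x m∉))))
        (sym (trans (sym (sub-as-subVN wkSub (sub θ' (absN cs (inst-a x))))) (trans (cong (sub wkSub) (absN-sub θ' nθ' cs (inst-a x))) (absN-sub wkSub (λ v b ()) cs _))))))

    trF-instance : ∀ {Σ'} (θ' : Sub Δ Σ') → NomFreeSub θ' → (c : Ann) (B : Fm Γ) →
      trF var c (subF (θ⇑ θ') B) ≡ subF θ' (trF θ c B)
    trF-instance θ' nθ' (π₁ , a₁) B = begin
        trF var (π₁ , a₁) (subF (θ⇑ θ') B)
      ≡⟨ trF-subF var nomFreeSub-var π₁ a₁ (θ⇑ θ') B ⟩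
        subVNF (λ v → subVN (closeAt var (fι π₁ a₁)) (permNames π₁) (θ⇑ θ' v)) (permNames π₁) B
      ≡⟨ subVNF-cong (λ v → closeAt-θ⇑ v) (λ _ _ → refl) B ⟩
        subVNF (λ v → subVN θ' nomc (closeAt θ (fι π₁ a₁) v)) (λ ι' k → subVN θ' nomc (permNames π₁ ι' k)) B
      ≡⟨ sym (subVNF-subVNF θ' nomc (closeAt θ (fι π₁ a₁)) (permNames π₁) B) ⟩
        subVNF θ' nomc (subVNF (closeAt θ (fι π₁ a₁)) (permNames π₁) B)
      ≡⟨ sym (trans (subF-as-subVN θ' _) (cong (subVNF θ' nomc) (trF-as-subVN θ nθ π₁ a₁ B))) ⟩
        subF θ' (trF θ (π₁ , a₁) B)
      ∎ where
      open ≡-Reasoning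
      m₁ = fι π₁ a₁
      θ'ₘ : Sub (nom ι ∷ Δ) _
      θ'ₘ here = nomc ι m₁
      θ'ₘ (there w) = θ' w
      closeAt-θ⇑ : ∀ {τ'} (v : Var Γ τ') → subVN (closeAt var m₁) (permNames π₁) (θ⇑ θ' v) ≡ subVN θ' nomc (closeAt θ m₁ v)
      closeAt-θ⇑ v = begin
          subVN (closeAt var m₁) (permNames π₁) (sub (extS θ') (θ v))
        ≡⟨ subVN-nomFree-cong (sub (extS θ') (θ v)) (nθ⇑ θ' nθ' v) (λ w → refl) ⟩
          subVN (closeAt var m₁) nomc (sub (extS θ') (θ v))
        ≡⟨ trans (cong (subVN (closeAt var m₁) nomc) (sub-as-subVN (extS θ') (θ v))) (subVN-subVN (closeAt var m₁) nomc (extS θ') nomc (θ v)) ⟩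
          subVN (λ w → subVN (closeAt var m₁) nomc (extS θ' w)) nomc (θ v)
        ≡⟨ subVN-cong (λ { here → refl ; (there w) → trans (subVN-ren (closeAt var m₁) nomc there (θ' w)) (trans (subVN-cong (λ _ → refl) (λ _ _ → refl) (θ' w)) (subVN-id (θ' w))) }) (λ _ _ → refl) (θ v) ⟩
          subVN θ'ₘ nomc (θ v)
        ≡⟨ sym (trans (cong (subVN θ' nomc) (sub-as-subVN (inst (nomc ι m₁)) (θ v))) (trans (subVN-subVN θ' nomc (inst (nomc ι m₁)) nomc (θ v)) (subVN-cong (λ { here → refl ; (there w) → refl }) (λ _ _ → refl) (θ v)))) ⟩
          subVN θ' nomc (sub (inst (nomc ι m₁)) (θ v))
        ∎

  trTs-as-subVN : ∀ {Γ Δ Ξ} (θ : Sub Γ (nom ι ∷ Δ)) → NomFreeSub θ → (π : Perm) (a : ℕ) (ts : Tms Γ Ξ) →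
    permTs π (subTs (inst (nomc ι a)) (subTs θ ts)) ≡ subVNs (closeAt θ (fι π a)) (permNames π) ts
  trTs-as-subVN θ nθ π a [] = refl
  trTs-as-subVN θ nθ π a (t ∷ ts) = cong₂ _∷_ (trT-as-subVN θ nθ π a t) (trTs-as-subVN θ nθ π a ts)

  trF-unfold : ∀ {Γ Δ Ξ} (θ : Sub Γ (nom ι ∷ Δ)) → NomFreeSub θ → (π : Perm) (a : ℕ) (ts : Tms Γ Ξ) (Bd : Fm Ξ) → (∀ b → ¬ occF b Bd) →
    trF θ (π , a) (subF (tmsSub ts) Bd) ≡ subF (tmsSub (permTs π (subTs (inst (nomc ι a)) (subTs θ ts)))) Bd
  trF-unfold θ nθ π a ts Bd nb = trans (trF-subF θ nθ π a (tmsSub ts) Bd)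
    (trans (subVNF-cong-occ Bd (λ v _ → trans (sym (tmsSub-subVN (closeAt θ (fι π a)) (permNames π) ts v)) (cong (λ z → tmsSub z v) (sym (trTs-as-subVN θ nθ π a ts))))
                              (λ ι' k o → ⊥-elim (nb _ o)))
           (sym (subF-as-subVN _ Bd)))

  ≈-trT : ∀ {Γ Δ τ} (θ : Sub Γ (nom ι ∷ Δ)) → NomFreeSub θ → (c : Ann) {s t : Tm Γ τ} → s ≈ t → trT θ c s ≈ trT θ c t
  ≈-trT θ nθ (π , a) {s} {t} r = ≡-≈ (trT-as-subVN θ nθ π a s) (≈-≡ (≈-subVN (closeAt θ (fι π a)) (permNames π) r) (sym (trT-as-subVN θ nθ π a t)))

module Admissibility (𝒮 : Sig) (𝒟 : LG.Definitions 𝒮) (ι : ℕ) where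

  open LG 𝒮
  open Seq 𝒟
  open Definitions 𝒟
  open Syntax 𝒮
  open NameSubstitution 𝒮 ι

  θ₀ : Sub [] (nom ι ∷ [])
  θ₀ ()

  nomFreeSub-θ₀ : NomFreeSub θ₀
  nomFreeSub-θ₀ ()

  θ₁ : Sub (num ∷ []) (nom ι ∷ num ∷ [])
  θ₁ v = var (there v)

  nomFreeSub-θ₁ : NomFreeSub θ₁
  nomFreeSub-θ₁ v b ()

  trF-natL-base : (c : Ann) (D : Fm (num ∷ [])) → trF θ₀ c (subF (inst zc) D) ≡ subF (inst zc) (permF (proj₁ c) D)
  trF-natL-base (π , a) D = trans (trF-subF θ₀ nomFreeSub-θ₀ π a (inst zc) D)
    (trans (subVNF-cong (λ { here → refl }) (λ _ _ → refl) D) (sym (subF-permF (inst zc) π D)))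

  trF-natL-hyp : (c : Ann) (D : Fm (num ∷ [])) → trF θ₁ c D ≡ permF (proj₁ c) D
  trF-natL-hyp (π , a) D = trans (trF-as-subVN θ₁ nomFreeSub-θ₁ π a D)
    (trans (subVNF-cong (λ { here → refl }) (λ _ _ → refl) D) (sym (permF-as-subVN π D)))

  trF-natL-step : (c : Ann) (D : Fm (num ∷ [])) → trF θ₁ c (subF sSub D) ≡ subF sSub (permF (proj₁ c) D)
  trF-natL-step (π , a) D = trans (trF-subF θ₁ nomFreeSub-θ₁ π a sSub D)
    (trans (subVNF-cong (λ { here → refl }) (λ _ _ → refl) D) (sym (subF-permF sSub π D)))

  trF-natL-major : ∀ {Γ Δ} (θ : Sub Γ (nom ι ∷ Δ)) → NomFreeSub θ → (π : Perm) (a f : ℕ) (I : Tm Γ num) (D : Fm (num ∷ [])) →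
    ¬ occT (ι , a) I → ¬ occT (ι , f) I →
    trF θ (swapAnn π a f) (subF (closedInst I) D) ≡ subF (closedInst (trT θ (π , a) I)) (permF (π ∘P swapP ι a f) D)
  trF-natL-major θ nθ π a f I D na nf = trans (trF-subF θ nθ π' f (closedInst I) D)
    (trans (subVNF-cong (λ { here → trans (cong (λ z → subVN (closeAt θ z) (permNames π') I) (fι-swap π a f))
                                             (trans (subVN-cong-occ I (λ v _ → refl) permNames-agree)
                                                    (sym (trT-as-subVN θ nθ π a I))) }) (λ _ _ → refl) D)
           (sym (subF-permF (closedInst (trT θ (π , a) I)) π' D)))
    where
    π' = π ∘P swapP ι a f
    permNames-agree : ∀ ι' k → occT (ι' , k) I → permNames π' ι' k ≡ permNames π ι' k
    permNames-agree ι' k o = permNames-swap π a f ι' k (λ e → na (subst (λ z → occT z I) e o)) (λ e → nf (subst (λ z → occT z I) e o))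

  Hyps : Ctx → Set
  Hyps Σ' = List (Fm Σ' × Ann)

  FreshHyp : ∀ {Σ'} → Fm Σ' × Ann → Set
  FreshHyp (B , (π , a)) = ¬ occF (ι , a) B

  trH : ∀ {Γ Δ} → Sub Γ (nom ι ∷ Δ) → Fm Γ × Ann → Fm Δ
  trH θ (B , c) = trF θ c B

  cast : ∀ {Σ' Γ Γ' C C'} {e : AnyProof} → Γ ≡ Γ' → C ≡ C' →
    Σ[ d ∈ Proof Σ' Γ C ] (⟨ d ⟩ ⊑ e) → Σ[ d ∈ Proof Σ' Γ' C' ] (⟨ d ⟩ ⊑ e)
  cast refl refl r = r

  pickHyp : ∀ {Σ'} {L : Hyps Σ'} {Γ Γ₀ : List (Fm Σ')} {B : Fm Σ'} → map proj₁ L ≡ Γ → Γ ↭ (B ∷ Γ₀) → All FreshHyp L →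
    Σ[ c ∈ Ann ] Σ[ L₀ ∈ Hyps Σ' ] (L ↭ ((B , c) ∷ L₀)) × (map proj₁ L₀ ≡ Γ₀) × FreshHyp (B , c) × All FreshHyp L₀
  pickHyp {L = L} refl p gL with ↭-map-inv proj₁ p
  ... | (x ∷ L₀) , refl , q = proj₂ x , L₀ , q , refl , All.head (All-resp-↭ q gL) , All.tail (All-resp-↭ q gL)

  splitCutHyps : ∀ {Σ'} {n} {Δs : Fin n → List (Fm Σ')} {Γ₀} (L : Hyps Σ') → map proj₁ L ↭ concat (tabulate Δs) ++ Γ₀ →
    Σ[ Ls ∈ (Fin n → Hyps Σ') ] Σ[ L₀ ∈ Hyps Σ' ]
      (L ↭ concat (tabulate Ls) ++ L₀) × (∀ i → map proj₁ (Ls i) ≡ Δs i) × (map proj₁ L₀ ≡ Γ₀)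
  splitCutHyps {n = n} {Δs} L p with ↭-map-inv proj₁ p
  ... | L' , eL' , q with map-++⁻ proj₁ L' (concat (tabulate Δs)) _ (sym eL')
  ... | L₁ , L₀ , refl , e₁ , e₀ with map-concat⁻ proj₁ n Δs L₁ e₁
  ... | Ls , refl , eLs = Ls , L₀ , q , eLs , e₀

  map-trH-concat : ∀ {Γ Δ} (θ : Sub Γ (nom ι ∷ Δ)) {n} (Ls : Fin n → Hyps Γ) (L₀ : Hyps Γ) →
    map (trH θ) (concat (tabulate Ls) ++ L₀) ≡ concat (tabulate (λ i → map (trH θ) (Ls i))) ++ map (trH θ) L₀
  map-trH-concat θ Ls L₀ = trans (LP.map-++ (trH θ) (concat (tabulate Ls)) L₀)
    (cong (_++ map (trH θ) L₀) (trans (sym (LP.concat-map (tabulate Ls))) (cong concat (LP.map-tabulate Ls (map (trH θ))))))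

  wkH : ∀ {Σ' σ₀} → Fm Σ' × Ann → Fm (σ₀ ∷ Σ') × Ann
  wkH (B , c) = (wkF B , c)

  wkH-fst : ∀ {Σ' σ₀} (L : Hyps Σ') {Γ} → map proj₁ L ≡ Γ → map proj₁ (map (wkH {σ₀ = σ₀}) L) ≡ map wkF Γ
  wkH-fst [] refl = refl
  wkH-fst (x ∷ L) refl = cong (_ ∷_) (wkH-fst L refl)

  wkH-fresh : ∀ {Σ' σ₀} (L : Hyps Σ') → All FreshHyp L → All FreshHyp (map (wkH {σ₀ = σ₀}) L)
  wkH-fresh [] [] = []
  wkH-fresh ((B , (π , a)) ∷ L) (g ∷ gs) = fresh-wkF (ι , a) B g ∷ wkH-fresh L gs

  wkH-trH : ∀ {Γ Δ σ₀ σ₁} (θ : Sub Γ (nom ι ∷ Δ)) (θ↑ : Sub (σ₀ ∷ Γ) (nom ι ∷ σ₁ ∷ Δ)) →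
    (∀ c B → trF θ↑ c (wkF B) ≡ wkF {σ = σ₁} (trF θ c B)) → (L : Hyps Γ) → map (trH θ↑) (map wkH L) ≡ map wkF (map (trH θ) L)
  wkH-trH θ θ↑ h [] = refl
  wkH-trH θ θ↑ h ((B , c) ∷ L) = cong₂ _∷_ (h c B) (wkH-trH θ θ↑ h L)

  subH : ∀ {Γ Σ'} → Sub Γ Σ' → Fm Γ × Ann → Fm Σ' × Ann
  subH σ (B , c) = (subF σ B , c)

  subH-fst : ∀ {Γ Σ'} (σ : Sub Γ Σ') (L : Hyps Γ) {Γ₀} → map proj₁ L ≡ Γ₀ → map proj₁ (map (subH σ) L) ≡ map (subF σ) Γ₀
  subH-fst σ [] refl = refl
  subH-fst σ (x ∷ L) refl = cong (_ ∷_) (subH-fst σ L refl)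

  subH-fresh : ∀ {Γ Σ'} (σ : Sub Γ Σ') → NomFreeSub σ → (L : Hyps Γ) → All FreshHyp L → All FreshHyp (map (subH σ) L)
  subH-fresh σ nσ [] [] = []
  subH-fresh σ nσ ((B , (π , a)) ∷ L) (g ∷ gs) = fresh-subF-nomFree σ nσ (ι , a) B g ∷ subH-fresh σ nσ L gs

  subH-trH : ∀ {Γ Δ Σ'} (θ : Sub Γ (nom ι ∷ Δ)) (θ' : Sub Δ Σ') (θ⇑ : Sub Γ (nom ι ∷ Σ')) →
    (∀ c B → trF var c (subF θ⇑ B) ≡ subF θ' (trF θ c B)) → (L : Hyps Γ) → map (trH var) (map (subH θ⇑) L) ≡ map (subF θ') (map (trH θ) L)
  subH-trH θ θ' θ⇑ h [] = refl
  subH-trH θ θ' θ⇑ h ((B , c) ∷ L) = cong₂ _∷_ (h c B) (subH-trH θ θ' θ⇑ h L)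

  Translated : ∀ {Σ' Γ C} → Proof Σ' Γ C → ∀ {Σ₁} → Sub Σ' (nom ι ∷ Σ₁) → Hyps Σ' → Ann → Set
  Translated {C = C} d {Σ₁} θ L c = Σ[ d' ∈ Proof Σ₁ (map (trH θ) L) (trF θ c C) ] (⟨ d' ⟩ ⊑ ⟨ d ⟩)

  translate : ∀ {Σ' Γ C} (d : Proof Σ' Γ C) {Σ₁} (θ : Sub Σ' (nom ι ∷ Σ₁)) → NomFreeSub θ →
    (L : Hyps Σ') → map proj₁ L ≡ Γ → All FreshHyp L → (c : Ann) → ¬ occF (ι , proj₂ c) C → Translated d θ L c
  translate (idπ p πh π' r) θ nθ L L≡ a∉L (π₀ , a₀) a∉C with pickHyp L≡ p a∉L
  ... | (πB , aB) , L₀ , q , L₀≡ , a∉B , a∉L₀ with trF-idπ θ nθ πh π' _ _ πB aB a∉B π₀ a₀ a∉C r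
  ... | σ , σ' , r' = idπ (PP.map⁺ (trH θ) q) σ σ' r' , ht≤ λ ()
  translate (mc n Δs Bs ds d p) θ nθ L refl a∉L c a∉C with splitCutHyps L p
  ... | Ls , L₀ , q , Ls≡ , L₀≡ =
    mc n (λ i → map (trH θ) (Ls i)) (λ i → trF θ (cc i) (Bs i)) (λ i → proj₁ (cuts i)) d'
       (subst (map (trH θ) L ↭_) (map-trH-concat θ Ls L₀) (PP.map⁺ (trH θ) q)) ,
    ht≤ λ { (inj₁ i) → inj₁ i , proj₂ (cuts i) ; (inj₂ tt) → inj₂ tt , d'⊑d }
    where
    a∉Ls++L₀ = AllP.++⁻ (concat (tabulate Ls)) (All-resp-↭ q a∉L)
    a∉Ls : ∀ i → All FreshHyp (Ls i)
    a∉Ls = AllP.tabulate⁻ {f = Ls} (AllP.concat⁻ {xss = tabulate Ls} (proj₁ a∉Ls++L₀))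
    cc : Fin n → Ann
    cc i = (idP , fresh (maxF (Bs i)) 0)
    a∉Bs : ∀ i → ¬ occF (ι , proj₂ (cc i)) (Bs i)
    a∉Bs i = freshˡ-F ι (Bs i) 0
    cuts : ∀ i → Translated (ds i) θ (Ls i) (cc i)
    cuts i = translate (ds i) θ nθ (Ls i) (Ls≡ i) (a∉Ls i) (cc i) (a∉Bs i)
    Lc = tabulate (λ i → (Bs i , cc i))
    cut-hyps : map (trH θ) (Lc ++ L₀) ≡ tabulate (λ i → trF θ (cc i) (Bs i)) ++ map (trH θ) L₀
    cut-hyps = trans (LP.map-++ (trH θ) Lc L₀) (cong (_++ map (trH θ) L₀) (LP.map-tabulate _ (trH θ)))
    main = cast cut-hyps refl
      (translate d θ nθ (Lc ++ L₀) (trans (LP.map-++ proj₁ Lc L₀) (cong₂ _++_ (LP.map-tabulate _ proj₁) L₀≡))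
                 (AllP.++⁺ (AllP.tabulate⁺ a∉Bs) (proj₂ a∉Ls++L₀)) c a∉C)
    d' = proj₁ main
    d'⊑d = proj₂ main
  translate (cL p d) θ nθ L L≡ a∉L c a∉C with pickHyp L≡ p a∉L
  ... | _ , L₀ , q , L₀≡ , a∉B , a∉L₀ =
    let (d' , d'⊑d) = translate d θ nθ (_ ∷ _ ∷ L₀) (cong (λ z → _ ∷ _ ∷ z) L₀≡) (a∉B ∷ a∉B ∷ a∉L₀) c a∉C
    in cL (PP.map⁺ (trH θ) q) d' , ht≤ λ _ → tt , d'⊑d
  translate (botL p) θ nθ L L≡ a∉L c a∉C with pickHyp L≡ p a∉L
  ... | _ , _ , q , _ = botL (PP.map⁺ (trH θ) q) , ht≤ λ ()
  translate topR θ nθ L L≡ a∉L c a∉C = topR , ht≤ λ ()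
  translate (andL₁ p d) θ nθ L L≡ a∉L c a∉C with pickHyp L≡ p a∉L
  ... | _ , L₀ , q , L₀≡ , a∉B , a∉L₀ =
    let (d' , d'⊑d) = translate d θ nθ (_ ∷ L₀) (cong (_ ∷_) L₀≡) ((λ o → a∉B (inj₁ o)) ∷ a∉L₀) c a∉C
    in andL₁ (PP.map⁺ (trH θ) q) d' , ht≤ λ _ → tt , d'⊑d
  translate (andL₂ p d) θ nθ L L≡ a∉L c a∉C with pickHyp L≡ p a∉L
  ... | _ , L₀ , q , L₀≡ , a∉B , a∉L₀ =
    let (d' , d'⊑d) = translate d θ nθ (_ ∷ L₀) (cong (_ ∷_) L₀≡) ((λ o → a∉B (inj₂ o)) ∷ a∉L₀) c a∉C
    in andL₂ (PP.map⁺ (trH θ) q) d' , ht≤ λ _ → tt , d'⊑d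
  translate (andR d₁ d₂) θ nθ L L≡ a∉L c a∉C =
    let (d₁' , d₁'⊑d₁) = translate d₁ θ nθ L L≡ a∉L c (λ o → a∉C (inj₁ o))
        (d₂' , d₂'⊑d₂) = translate d₂ θ nθ L L≡ a∉L c (λ o → a∉C (inj₂ o))
    in andR d₁' d₂' , ht≤ λ { Fin.zero → Fin.zero , d₁'⊑d₁ ; (Fin.suc _) → Fin.suc Fin.zero , d₂'⊑d₂ }
  translate (orL p d₁ d₂) θ nθ L L≡ a∉L c a∉C with pickHyp L≡ p a∉L
  ... | _ , L₀ , q , L₀≡ , a∉B , a∉L₀ =
    let (d₁' , d₁'⊑d₁) = translate d₁ θ nθ (_ ∷ L₀) (cong (_ ∷_) L₀≡) ((λ o → a∉B (inj₁ o)) ∷ a∉L₀) c a∉C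
        (d₂' , d₂'⊑d₂) = translate d₂ θ nθ (_ ∷ L₀) (cong (_ ∷_) L₀≡) ((λ o → a∉B (inj₂ o)) ∷ a∉L₀) c a∉C
    in orL (PP.map⁺ (trH θ) q) d₁' d₂' , ht≤ λ { Fin.zero → Fin.zero , d₁'⊑d₁ ; (Fin.suc _) → Fin.suc Fin.zero , d₂'⊑d₂ }
  translate (orR₁ d) θ nθ L L≡ a∉L c a∉C =
    let (d' , d'⊑d) = translate d θ nθ L L≡ a∉L c (λ o → a∉C (inj₁ o))
    in orR₁ d' , ht≤ λ _ → tt , d'⊑d
  translate (orR₂ d) θ nθ L L≡ a∉L c a∉C =
    let (d' , d'⊑d) = translate d θ nθ L L≡ a∉L c (λ o → a∉C (inj₂ o))
    in orR₂ d' , ht≤ λ _ → tt , d'⊑d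
  translate (impL p d₁ d₂) θ nθ L L≡ a∉L c a∉C with pickHyp L≡ p a∉L
  ... | cB , L₀ , q , L₀≡ , a∉B , a∉L₀ =
    let (d₁' , d₁'⊑d₁) = translate d₁ θ nθ L₀ L₀≡ a∉L₀ cB (λ o → a∉B (inj₁ o))
        (d₂' , d₂'⊑d₂) = translate d₂ θ nθ (_ ∷ L₀) (cong (_ ∷_) L₀≡) ((λ o → a∉B (inj₂ o)) ∷ a∉L₀) c a∉C
    in impL (PP.map⁺ (trH θ) q) d₁' d₂' , ht≤ λ { Fin.zero → Fin.zero , d₁'⊑d₁ ; (Fin.suc _) → Fin.suc Fin.zero , d₂'⊑d₂ }
  translate (impR d) θ nθ L L≡ a∉L c a∉C =
    let (d' , d'⊑d) = translate d θ nθ (_ ∷ L) (cong (_ ∷_) L≡) ((λ o → a∉C (inj₁ o)) ∷ a∉L) c (λ o → a∉C (inj₂ o))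
    in impR d' , ht≤ λ _ → tt , d'⊑d
  translate (allL {B = Q} p t d) θ nθ L L≡ a∉L c a∉C with pickHyp L≡ p a∉L
  ... | (πB , aB) , L₀ , q , L₀≡ , a∉B , a∉L₀ =
    let f = fresh (maxF Q) (maxT t)
        f∉Q = freshˡ-F ι Q (maxT t)
        (d' , d'⊑d) = cast (cong (_∷ map (trH θ) L₀) (trF-inst θ nθ πB aB f Q t a∉B f∉Q)) refl
          (translate d θ nθ (_ ∷ L₀) (cong (_ ∷_) L₀≡) (fresh-inst f Q t f∉Q (freshʳ-T ι (maxF Q) t) ∷ a∉L₀) c a∉C)
    in allL (PP.map⁺ (trH θ) q) _ d' , ht≤ λ _ → tt , d'⊑d
  translate (exR {B = Q} t d) θ nθ L L≡ a∉L (π₀ , a₀) a∉C =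
    let f = fresh (maxF Q) (maxT t)
        f∉Q = freshˡ-F ι Q (maxT t)
        (d' , d'⊑d) = cast refl (trF-inst θ nθ π₀ a₀ f Q t a∉C f∉Q)
          (translate d θ nθ L L≡ a∉L (swapAnn π₀ a₀ f) (fresh-inst f Q t f∉Q (freshʳ-T ι (maxF Q) t)))
    in exR _ d' , ht≤ λ _ → tt , d'⊑d
  translate (allR {B = Q} cs ls d) θ nθ L L≡ a∉L (π₀ , a₀) a∉C =
    let open Raising θ nθ π₀ a₀ Q cs ls a∉C
        (d' , d'⊑d) = cast (wkH-trH θ θ↑ trF-wk L) trF-raise
          (translate d θ↑ nθ↑ (map wkH L) (wkH-fst L L≡) (wkH-fresh L a∉L) (π₀ , a₀) a-fresh)
    in allR cs' ls' d' , ht≤ λ _ → tt , d'⊑d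
  translate (exL {B = Q} {C = C} p cs ls d) θ nθ L L≡ a∉L c a∉C with pickHyp L≡ p a∉L
  ... | (πB , aB) , L₀ , q , L₀≡ , a∉B , a∉L₀ =
    let open Raising θ nθ πB aB Q cs ls a∉B
        (d' , d'⊑d) = cast (cong₂ _∷_ trF-raise (wkH-trH θ θ↑ trF-wk L₀)) (trF-wk c C)
          (translate d θ↑ nθ↑ (_ ∷ map wkH L₀) (cong (_ ∷_) (wkH-fst L₀ L₀≡)) (a-fresh ∷ wkH-fresh L₀ a∉L₀) c (fresh-wkF _ C a∉C))
    in exL (PP.map⁺ (trH θ) q) cs' ls' d' , ht≤ λ _ → tt , d'⊑d
  translate (nabL {ι = ι'} {B = B} p k k∉B d) θ nθ L L≡ a∉L c a∉C with pickHyp L≡ p a∉L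
  ... | (πB , aB) , L₀ , q , L₀≡ , a∉B , a∉L₀ =
    let open Nab θ nθ πB aB ι' k B k∉B a∉B
        (d' , d'⊑d) = cast (cong (_∷ map (trH θ) L₀) trF-nab) refl
          (translate d θ nθ (_ ∷ L₀) (cong (_ ∷_) L₀≡) (a'-fresh ∷ a∉L₀) c a∉C)
    in nabL (PP.map⁺ (trH θ) q) k' k'-fresh d' , ht≤ λ _ → tt , d'⊑d
  translate (nabR {ι = ι'} {B = B} k k∉B d) θ nθ L L≡ a∉L (π₀ , a₀) a∉C =
    let open Nab θ nθ π₀ a₀ ι' k B k∉B a∉C
        (d' , d'⊑d) = cast refl trF-nab (translate d θ nθ L L≡ a∉L c' a'-fresh)
    in nabR k' k'-fresh d' , ht≤ λ _ → tt , d'⊑d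
  translate (eqR r) θ nθ L L≡ a∉L c a∉C = eqR (≈-trT θ nθ c r) , ht≤ λ ()
  translate (eqL {C = C} {s = s} {t = t} p cs ls ds) θ nθ L L≡ a∉L c a∉C with pickHyp L≡ p a∉L
  ... | (πB , aB) , L₀ , q , L₀≡ , a∉B , a∉L₀ =
    eqL (PP.map⁺ (trH θ) q) cs' ls' (λ Σ' θ' nθ' u → proj₁ (instance↦ Σ' θ' nθ' u)) ,
    ht≤ λ { (Σ' , θ' , nθ' , u) → (nom ι ∷ Σ' , θ⇑ θ' , nθ⇑ θ' nθ' , unifier-back θ' nθ' u) , proj₂ (instance↦ Σ' θ' nθ' u) }
    where
    open EqL θ nθ πB aB s t cs ls a∉B
    instance↦ : ∀ Σ' (θ' : Sub _ Σ') (nθ' : NomFreeSub θ') u →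
      Σ[ d' ∈ Proof Σ' (map (subF θ') (map (trH θ) L₀)) (subF θ' (trF θ c C)) ]
        (⟨ d' ⟩ ⊑ ⟨ ds (nom ι ∷ Σ') (θ⇑ θ') (nθ⇑ θ' nθ') (unifier-back θ' nθ' u) ⟩)
    instance↦ Σ' θ' nθ' u = cast (subH-trH θ θ' (θ⇑ θ') (trF-instance θ' nθ') L₀) (trF-instance θ' nθ' c C)
      (translate (ds (nom ι ∷ Σ') (θ⇑ θ') (nθ⇑ θ' nθ') (unifier-back θ' nθ' u)) var nomFreeSub-var
                 (map (subH (θ⇑ θ')) L₀) (subH-fst (θ⇑ θ') L₀ L₀≡) (subH-fresh (θ⇑ θ') (nθ⇑ θ' nθ') L₀ a∉L₀)
                 c (fresh-subF-nomFree (θ⇑ θ') (nθ⇑ θ' nθ') (ι , proj₂ c) C a∉C))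
  translate (defL {B = Bd} {ts = ts} p e d) θ nθ L L≡ a∉L c a∉C with pickHyp L≡ p a∉L
  ... | (πB , aB) , L₀ , q , L₀≡ , a∉B , a∉L₀ =
    let Bd-closed = nomfree _ Bd e
        (d' , d'⊑d) = cast (cong (_∷ map (trH θ) L₀) (trF-unfold θ nθ πB aB ts Bd Bd-closed)) refl
          (translate d θ nθ (_ ∷ L₀) (cong (_ ∷_) L₀≡) (fresh-unfold (ι , aB) ts Bd Bd-closed a∉B ∷ a∉L₀) c a∉C)
    in defL (PP.map⁺ (trH θ) q) e d' , ht≤ λ _ → tt , d'⊑d
  translate (defR {B = Bd} {ts = ts} e d) θ nθ L L≡ a∉L (π₀ , a₀) a∉C =
    let Bd-closed = nomfree _ Bd e
        (d' , d'⊑d) = cast refl (trF-unfold θ nθ π₀ a₀ ts Bd Bd-closed)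
          (translate d θ nθ L L≡ a∉L (π₀ , a₀) (fresh-unfold (ι , a₀) ts Bd Bd-closed a∉C))
    in defR e d' , ht≤ λ _ → tt , d'⊑d
  translate (natRz r) θ nθ L L≡ a∉L c a∉C = natRz (≈-trT θ nθ c r) , ht≤ λ ()
  translate (natRs {t = t} {I = I} r d) θ nθ L L≡ a∉L (π₀ , a₀) a∉C =
    let f = fresh (maxT t) (maxT I)
        (d' , d'⊑d) = translate d θ nθ L L≡ a∉L (swapAnn π₀ a₀ f) (freshʳ-T ι (maxT t) I)
    in natRs (trT-succ θ nθ π₀ a₀ f t I a∉C (freshˡ-T ι t (maxT I)) r) d' , ht≤ λ _ → tt , d'⊑d
  translate (natL {I = I} p D d₁ d₂ d₃) θ nθ L L≡ a∉L c a∉C with pickHyp L≡ p a∉L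
  ... | (πB , aB) , L₀ , q , L₀≡ , a∉B , a∉L₀ =
    natL (PP.map⁺ (trH θ) q) (permF (πB ∘P swapP ι aB f) D) (proj₁ zero↦) (proj₁ succ↦) (proj₁ major↦) ,
    ht≤ λ { Fin.zero → Fin.zero , proj₂ zero↦ ; (Fin.suc Fin.zero) → Fin.suc Fin.zero , proj₂ succ↦
          ; (Fin.suc (Fin.suc _)) → Fin.suc (Fin.suc Fin.zero) , proj₂ major↦ }
    where
    f = fresh (maxF D) (maxT I)
    c' = swapAnn πB aB f
    f∉D : ¬ occF (ι , f) D
    f∉D = freshˡ-F ι D (maxT I)
    f∉I : ¬ occT (ι , f) I
    f∉I = freshʳ-T ι (maxF D) I
    zero↦ = cast refl (trF-natL-base c' D)
      (translate d₁ θ₀ nomFreeSub-θ₀ [] refl [] c' (fresh-subF (inst zc) _ D f∉D λ { here () }))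
    succ↦ = cast (cong (_∷ []) (trF-natL-hyp c' D)) (trF-natL-step c' D)
      (translate d₂ θ₁ nomFreeSub-θ₁ ((D , c') ∷ []) refl (f∉D ∷ []) c' (fresh-subF sSub _ D f∉D λ { here (inj₁ ()) ; here (inj₂ ()) }))
    major↦ = cast (cong (_∷ map (trH θ) L₀) (trF-natL-major θ nθ πB aB f I D a∉B f∉I)) refl
      (translate d₃ θ nθ (_ ∷ L₀) (cong (_ ∷_) L₀≡) (fresh-subF (closedInst I) _ D f∉D (λ { here o → f∉I o }) ∷ a∉L₀) c a∉C)

lemma7 : (𝒮 : Sig) → let open LG 𝒮 in
    (𝒟 : Definitions) → let open Seq 𝒟 in
    (Sg : Ctx) (ι : ℕ) (n : ℕ)
    (B₀ : Fm (nom ι ∷ Sg)) (Bs : Fin n → Fm (nom ι ∷ Sg))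
    (Π : Proof (nom ι ∷ Sg) (tabulate Bs) B₀)
    (a₀ : ℕ) (as : Fin n → ℕ) →
    ¬ occF (ι , a₀) B₀ →
    (∀ i → ¬ occF (ι , as i) (Bs i)) →
    Σ[ Π' ∈ Proof Sg (tabulate (λ i → subF (inst (nomc ι (as i))) (Bs i)))
    (subF (inst (nomc ι a₀)) B₀) ]
    (⟨ Π' ⟩ ⊑ ⟨ Π ⟩)
lemma7 𝒮 𝒟 Sg ι n B₀ Bs Π a₀ as a₀∉B₀ as∉Bs =
  cast hyps (trF-id a₀ B₀)
    (translate Π var nomFreeSub-var L (LP.map-tabulate _ proj₁) (AllP.tabulate⁺ as∉Bs) (idP , a₀) a₀∉B₀)
  where
  open LG 𝒮
  open Syntax 𝒮
  open NameSubstitution 𝒮 ι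
  open Admissibility 𝒮 𝒟 ι
  L : Hyps (nom ι ∷ Sg)
  L = tabulate (λ i → (Bs i , (idP , as i)))
  hyps : map (trH var) L ≡ tabulate (λ i → subF (inst (nomc ι (as i))) (Bs i))
  hyps = trans (LP.map-tabulate _ (trH var)) (LP.tabulate-cong (λ i → trF-id (as i) (Bs i)))
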